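{- Let $\Delta=\Delta_{m,\mathbf a}^{(\mathbf r)}=\sum_{i=1}^n a_iP_m^{(r_i)}(x_i)$ (variables in $\mathbb N_0$) be a primitive regular shifted $m$-gonal form. (1) If $\Delta$ is not $\mathbb Z_p$-universal for some odd prime $p$, then its $\lambda_p$-transformation $\lambda_p(\Delta)$ is regular. (2) Suppose $m\equiv 0\pmod 4$. If $\langle a_1,\dots,a_n\rangle\otimes\mathbb Z_2$ does not represent $\langle u,u'\rangle\otimes\mathbb Z_2$ for any $u\equiv 1\pmod 4$ and $u'\equiv 3\pmod 4$, then its $\lambda_2$-transformation $\lambda_2(\Delta)$ is regular.
   Context: For an integer $m\ge 3$ and a positive integer $r$ with $\gcd(r,m-2)=1$, let $P_m^{(r)}(x)=\frac{m-2}{2}x^2-\frac{m-2-2r}{2}x$ for $x\in\mathbb N_0$. A shifted $m$-gonal form is $\Delta(\mathbf x)=\sum_{i=1}^n a_iP_m^{(r_i)}(x_i)$ with positive integers $a_i$, such levels $r_i$ and $\mathbf x\in\mathbb N_0^n$; primitive means $\gcd(a_1,\dots,a_n)=1$. It represents $N\in\mathbb N_0$ if $\Delta(\mathbf x)=N$ has a solution $\mathbf x\in\mathbb N_0^n$; it locally represents $N$ if the equation has a solution in $\mathbb Z_p^n$ for every prime $p$; it is regular if it represents every non-negative integer it locally represents; it is $\mathbb Z_p$-universal if $\Delta(\mathbf x)=N$ is solvable in $\mathbb Z_p^n$ for every $N\in\mathbb Z_p$. "$\langle a_1,\dots,a_n\rangle\otimes\mathbb Z_2$ represents $\langle u,u'\rangle\otimes\mathbb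 Z_2$" means the diagonal quadratic $\mathbb Z_2$-lattice contains a sublattice isometric to the binary one. $\lambda_p$-transformation (for $p$ an odd prime with $p\nmid m-2$, or $p=2$ with $m\equiv 0\pmod 4$): for each $i$ with $p\nmid a_i$, let $j_i$ be the integer with $0\le j_i\le p-1$ and $j_i\equiv\frac{m-2-2r_i}{2(m-2)}\pmod p$ (congruence in $\mathbb Z_p$), and $r_i'=\frac{(m-2)(p+2j_i)-(m-2-2r_i)}{2p}$ (a positive integer coprime to $m-2$). Then $\lambda_p(\Delta)(\mathbf x)=p^{ -k}\big(\sum_{p\nmid a_i}p^2a_iP_m^{(r_i')}(x_i)+\sum_{p\mid a_i}a_iP_m^{(r_i)}(x_i)\big)$, $\mathbf x\in\mathbb N_0^n$, where $k=\min\{2,\mathrm{ord}_p(a_i):p\mid a_i\}$. -}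

module Defs where

open import Data.Nat as ℕ using (ℕ; zero; suc; _≤_; _<_; _∸_; _^_)
open import Data.Nat.DivMod using (_/_)
open import Data.Nat.Divisibility as ℕD using ()
open import Data.Nat.Coprimality using (Coprime)
open import Data.Integer using (ℤ; +_; -[1+_]; _+_; _-_; _*_)
open import Data.Integer.Divisibility using (_∣_)
open import Data.Fin using (Fin; zero; suc)
open import Data.Product using (_×_; ∃; Σ)
open import Data.Sum using (_⊎_)
open import Relation.Nullary using (¬_)
open import Relation.Binary.PropositionalEquality using (_≡_)

-- x(x-1)/2 for x ∈ ℤ (always an integer)
tri : ℤ → ℤ
tri (+ n)    = + ((n ℕ.* (n ∸ 1)) / 2)
tri -[1+ n ] = + ((suc n ℕ.* suc (suc n)) / 2)

-- P_m^{(r)}(x) = ((m-2)/2) x^2 - ((m-2-2r)/2) x = (m-2)·x(x-1)/2 + r·x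
P : (m r : ℕ) → ℤ → ℤ
P m r x = + (m ∸ 2) * tri x + + r * x

sumℤ : ∀ {n} → (Fin n → ℤ) → ℤ
sumℤ {zero}  f = + 0
sumℤ {suc n} f = f zero + sumℤ (λ i → f (suc i))

evalΔ : (m n : ℕ) → (Fin n → ℕ) → (Fin n → ℕ) → (Fin n → ℤ) → ℤ
evalΔ m n a r x = sumℤ (λ i → + a i * P m (r i) (x i))

ShiftedForm : (m n : ℕ) → (Fin n → ℕ) → (Fin n → ℕ) → Set
ShiftedForm m n a r = 3 ≤ m × (∀ i → 0 < a i × 0 < r i × Coprime (r i) (m ∸ 2))

Primitive : (n : ℕ) → (Fin n → ℕ) → Set
Primitive n a = ∀ d → (∀ i → d ℕD.∣ a i) → d ℕD.∣ 1

Represents : (m n : ℕ) → (Fin n → ℕ) → (Fin n → ℕ) → ℕ → Set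
Represents m n a r N = ∃ λ (x : Fin n → ℕ) → evalΔ m n a r (λ i → + x i) ≡ + N

-- p-adic integers as the inverse limit of ℤ/p^k: coherent integer sequences
record ℤp (p : ℕ) : Set where
  field
    seq : ℕ → ℤ
    coh : ∀ k → + (p ^ k) ∣ (seq (suc k) - seq k)
open ℤp public

LimEq : (p : ℕ) → (ℕ → ℤ) → (ℕ → ℤ) → Set
LimEq p f g = ∀ k → ∃ λ K → ∀ j → K ≤ j → + (p ^ k) ∣ (f j - g j)

SolvableZp : (m n : ℕ) → (Fin n → ℕ) → (Fin n → ℕ) → (p : ℕ) → (ℕ → ℤ) → Set
SolvableZp m n a r p Ns =
  ∃ λ (x : Fin n → ℤp p) → LimEq p (λ j → evalΔ m n a r (λ i → seq (x i) j)) Ns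

LocallyRepresents : (m n : ℕ) → (Fin n → ℕ) → (Fin n → ℕ) → ℕ → Set
LocallyRepresents m n a r N = ∀ p → Prime p → SolvableZp m n a r p (λ _ → + N)
  where open import Data.Nat.Primality using (Prime)

Regular : (m n : ℕ) → (Fin n → ℕ) → (Fin n → ℕ) → Set
Regular m n a r = ∀ N → LocallyRepresents m n a r N → Represents m n a r N

ZpUniversal : (m n : ℕ) → (Fin n → ℕ) → (Fin n → ℕ) → ℕ → Set
ZpUniversal m n a r p = ∀ (N : ℤp p) → SolvableZp m n a r p (seq N)

-- j ≡ c/d (mod p) in ℤ_p (d ≠ 0):  (d j - c)/(p d) ∈ ℤ_(p) = ℚ ∩ ℤ_p
CongDivModP : (p : ℕ) → (j c d : ℤ) → Set
CongDivModP p j c d =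
  ∃ λ (s : ℤ) → ∃ λ (t : ℤ) → (¬ (+ p ∣ t)) × (t * (d * j - c) ≡ + p * d * s)

-- b, r' are the coefficients and levels of λ_p(Δ)
record IsLambda (m n : ℕ) (a r : Fin n → ℕ) (p : ℕ) (b r' : Fin n → ℕ) : Set where
  field
    -- k = min{2, ord_p(a_i) : p ∣ a_i}
    k          : ℕ
    k≤2        : k ≤ 2
    k-lower    : ∀ i → p ℕD.∣ a i → (p ^ k) ℕD.∣ a i
    k-attained : k ≡ 2 ⊎ ∃ λ i → p ℕD.∣ a i × ¬ ((p ^ suc k) ℕD.∣ a i)
    div-coeff  : ∀ i → p ℕD.∣ a i → (p ^ k) ℕ.* b i ≡ a i × r' i ≡ r i
    ndiv-coeff : ∀ i → ¬ (p ℕD.∣ a i) →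
      b i ≡ p ^ (2 ∸ k) ℕ.* a i ×
      ∃ λ j → j < p ×
        CongDivModP p (+ j) (+ (m ∸ 2) - + (2 ℕ.* r i)) (+ (2 ℕ.* (m ∸ 2))) ×
        (+ (2 ℕ.* p ℕ.* r' i) ≡ + (m ∸ 2) * (+ p + + 2 * + j) - (+ (m ∸ 2) - + (2 ℕ.* r i)))

Qa : ∀ {n} → (Fin n → ℕ) → (Fin n → ℤ) → (Fin n → ℤ) → ℤ
Qa a v w = sumℤ (λ i → + a i * v i * w i)

-- ⟨a_1,…,a_n⟩ ⊗ ℤ_2 represents ⟨u,u'⟩ ⊗ ℤ_2 : ∃ v,w ∈ ℤ_2^n with
-- Q(v) = u, Q(w) = u', B(v,w) = 0
RepresentsBinary2 : (n : ℕ) → (Fin n → ℕ) → ℤp 2 → ℤp 2 → Set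
RepresentsBinary2 n a u u' =
  ∃ λ (v : Fin n → ℤp 2) → ∃ λ (w : Fin n → ℤp 2) →
    LimEq 2 (λ j → Qa a (λ i → seq (v i) j) (λ i → seq (v i) j)) (seq u) ×
    LimEq 2 (λ j → Qa a (λ i → seq (w i) j) (λ i → seq (w i) j)) (seq u') ×
    LimEq 2 (λ j → Qa a (λ i → seq (v i) j) (λ i → seq (w i) j)) (λ _ → + 0)

CongZp : {p : ℕ} → ℤp p → ℤ → ℕ → Set
CongZp {p} x c e = + (p ^ e) ∣ (seq x e - c)

-- Let j_i be the residue attached to a coordinate with p ∤ a_i and substitute x_i = j_i + p y_i
-- (x_i = y_i when p ∣ a_i).  Then Δ(x) = p^k λ_p(Δ)(y) + Δ(j), so if λ_p(Δ) locally represents N,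
-- Δ locally represents p^k N + Δ(j), and regularity gives x ∈ ℕ₀ⁿ with Δ(x) = p^k N + Δ(j).  If x_i ≡ j_i
-- (mod p) for every i with p ∤ a_i, then x comes from some y ∈ ℕ₀ⁿ and λ_p(Δ)(y) = N.  Otherwise pick such an
-- i₀ with x_{i₀} ≢ j_{i₀} and put Z = x − j.  Since j_i is a critical point of P_m^{(r_i)} mod p, Taylor
-- expansion at j gives 2 p^k N ≡ (m − 2) Q(Z) modulo the derivative terms, with Q = ⟨a_1, …, a_n⟩.
-- For odd p, 2Δ restricted to the line (j + e_{i₀}) + y Z is α y² + β y + c with p ∣ α and p ∤ β, and
-- Newton iteration makes Δ ℤ_p-universal.  For p = 2 and 4 ∣ m it gives 2^k ∣ Q(Z) with Z_{i₀}, a_{i₀}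
-- odd; splitting off the i₀-coordinate (and, if k = 1, adding e_d for some a_d ≡ 2 mod 4) yields
-- orthogonal V, W with Q(V) odd and 4 ∣ Q(V) + Q(W), so ⟨a⟩ ⊗ ℤ_2 represents some ⟨u, u′⟩ with
-- u ≡ 1 and u′ ≡ 3 (mod 4).

module Submission where

open import Defs
open import Data.Nat using (ℕ)
open import Data.Nat.Divisibility using (_∣_)
open import Data.Nat.Primality using (Prime)
open import Data.Integer using (+_)
open import Data.Fin using (Fin)
open import Data.Product using (_×_)
open import Relation.Nullary using (¬_)

open import Data.Nat as ℕ using (zero; suc; _∸_; _^_; NonZero)
import Data.Nat.Properties as ℕP
import Data.Nat.Divisibility as ℕD
open import Data.Nat.Primality using (euclidsLemma; prime⇒nonZero; prime⇒irreducible; prime[2]; ¬prime[1])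
open import Data.Nat.Coprimality using (Coprime; coprime-Bézout)
open import Data.Nat.GCD using (module Bézout)
open import Data.Nat.DivMod using (_/_; _%_; m*[n/m]≡n; m≡m%n+[m/n]*n; m%n<n)
open import Data.Integer as ℤ using (ℤ; -[1+_]; _+_; _-_; _*_; -_; ∣_∣; _%ℕ_; _/ℕ_)
open import Data.Integer.DivMod using (n%ℕd<d; a≡a%ℕn+[a/ℕn]*n)
import Data.Integer.Properties as ℤP
import Data.Integer.Divisibility as ℤU
open import Data.Integer.Divisibility.Signed as ℤD using (divides) renaming (_∣_ to _∣ℤ_)
open import Data.Integer.Tactic.RingSolver using (solve-∀)
open import Data.Nat.Tactic.RingSolver using () renaming (solve-∀ to solveℕ)
open import Data.Fin using (zero; suc)
open import Data.Product as Product using (_,_; ∃; proj₁; proj₂)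
open import Data.Sum as Sum using (_⊎_; inj₁; inj₂)
open import Relation.Nullary using (Dec; contradiction; yes; no)
open import Relation.Nullary.Decidable using (decidable-stable)
open import Function using (_∘_; id)
open import Relation.Binary.PropositionalEquality using (_≡_; _≢_; refl; sym; trans; cong; cong₂; subst; subst₂; module ≡-Reasoning)
open import Algebra.Properties.Semiring.Sum ℤP.+-*-semiring using (sum; ∑-distrib-+; *-distribˡ-sum)

-- Finite sums

sumℤ≡sum : ∀ {n} (f : Fin n → ℤ) → sumℤ f ≡ sum f
sumℤ≡sum {zero}  f = refl
sumℤ≡sum {suc n} f = cong (λ s → f zero + s) (sumℤ≡sum (f ∘ suc))

sumℤ-cong : ∀ {n} {f g : Fin n → ℤ} → (∀ i → f i ≡ g i) → sumℤ f ≡ sumℤ g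
sumℤ-cong {zero}  f≗g = refl
sumℤ-cong {suc n} f≗g = cong₂ _+_ (f≗g zero) (sumℤ-cong (f≗g ∘ suc))

sumℤ-distrib-+ : ∀ {n} (f g : Fin n → ℤ) → sumℤ (λ i → f i + g i) ≡ sumℤ f + sumℤ g
sumℤ-distrib-+ f g = begin
  sumℤ (λ i → f i + g i) ≡⟨ sumℤ≡sum (λ i → f i + g i) ⟩
  sum (λ i → f i + g i)  ≡⟨ ∑-distrib-+ f g ⟩
  sum f + sum g          ≡⟨ cong₂ _+_ (sumℤ≡sum f) (sumℤ≡sum g) ⟨
  sumℤ f + sumℤ g        ∎
  where open ≡-Reasoning

*-distribˡ-sumℤ : ∀ {n} c (f : Fin n → ℤ) → c * sumℤ f ≡ sumℤ (λ i → c * f i)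
*-distribˡ-sumℤ c f = begin
  c * sumℤ f             ≡⟨ cong (c *_) (sumℤ≡sum f) ⟩
  c * sum f              ≡⟨ *-distribˡ-sum c f ⟩
  sum (λ i → c * f i)    ≡⟨ sumℤ≡sum (λ i → c * f i) ⟨
  sumℤ (λ i → c * f i)   ∎
  where open ≡-Reasoning

sumℤ-∣ : ∀ {n} {d} (f : Fin n → ℤ) → (∀ i → d ∣ℤ f i) → d ∣ℤ sumℤ f
sumℤ-∣ {zero} {d} f d∣f = divides (+ 0) (sym (ℤP.*-zeroˡ d))
sumℤ-∣ {suc n} f d∣f = ℤD.∣m∣n⇒∣m+n (d∣f zero) (sumℤ-∣ (f ∘ suc) (d∣f ∘ suc))

sumℤ-ℕ : ∀ {n} (f : Fin n → ℤ) → (∀ i → ∃ λ c → f i ≡ + c) → ∃ λ c → sumℤ f ≡ + c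
sumℤ-ℕ {zero}  f f-ℕ = 0 , refl
sumℤ-ℕ {suc n} f f-ℕ with f-ℕ zero | sumℤ-ℕ (f ∘ suc) (f-ℕ ∘ suc)
... | c , f₀≡c | s , sum≡s = c ℕ.+ s , trans (cong₂ _+_ f₀≡c sum≡s) (sym (ℤP.pos-+ c s))

δ : ∀ {n} → Fin n → Fin n → ℤ
δ zero    zero    = + 1
δ zero    (suc _) = + 0
δ (suc _) zero    = + 0
δ (suc d) (suc i) = δ d i

δ-refl : ∀ {n} (d : Fin n) → δ d d ≡ + 1
δ-refl zero    = refl
δ-refl (suc d) = δ-refl d

δ-≢ : ∀ {n} {d i : Fin n} → d ≢ i → δ d i ≡ + 0
δ-≢ {d = zero}  {zero}  d≢i = contradiction refl d≢i
δ-≢ {d = zero}  {suc i} d≢i = refl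
δ-≢ {d = suc d} {zero}  d≢i = refl
δ-≢ {d = suc d} {suc i} d≢i = δ-≢ (d≢i ∘ cong suc)

sumℤ-δ : ∀ {n} (d : Fin n) (f : Fin n → ℤ) → sumℤ (λ i → δ d i * f i) ≡ f d
sumℤ-δ {suc n} zero    f = begin
  + 1 * f zero + sumℤ (λ i → + 0 * f (suc i)) ≡⟨ cong₂ _+_ (ℤP.*-identityˡ (f zero)) (sym (*-distribˡ-sumℤ (+ 0) (f ∘ suc))) ⟩
  f zero + + 0 * sumℤ (f ∘ suc)               ≡⟨ ℤP.+-identityʳ (f zero) ⟩
  f zero                                      ∎
  where open ≡-Reasoning
sumℤ-δ {suc n} (suc d) f = trans (ℤP.+-identityˡ _) (sumℤ-δ d (f ∘ suc))

-- Divisibility and residues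

^-mono-∣ : ∀ p {k j} → k ℕ.≤ j → p ^ k ∣ p ^ j
^-mono-∣ p {k} {j} k≤j = ℕD.divides (p ^ (j ∸ k)) (begin
  p ^ j                 ≡⟨ cong (p ^_) (ℕP.m+[n∸m]≡n k≤j) ⟨
  p ^ (k ℕ.+ (j ∸ k))   ≡⟨ ℕP.^-distribˡ-+-* p k (j ∸ k) ⟩
  p ^ k ℕ.* p ^ (j ∸ k) ≡⟨ ℕP.*-comm (p ^ k) (p ^ (j ∸ k)) ⟩
  p ^ (j ∸ k) ℕ.* p ^ k ∎)
  where open ≡-Reasoning

prime^e-cancelˡ : ∀ {p t} e {z} → Prime p → ¬ p ∣ t → p ^ e ∣ t ℕ.* z → p ^ e ∣ z
prime^e-cancelˡ         zero    pr p∤t _ = ℕD.1∣ _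
prime^e-cancelˡ {p} {t} (suc e) pr p∤t pᵉ⁺¹∣tz with euclidsLemma t _ pr (ℕD.m*n∣⇒m∣ p (p ^ e) pᵉ⁺¹∣tz)
... | inj₁ p∣t = contradiction p∣t p∤t
... | inj₂ (ℕD.divides z′ refl) =
  subst (p ^ suc e ∣_) (ℕP.*-comm p z′) (ℕD.*-monoʳ-∣ p (prime^e-cancelˡ e pr p∤t pᵉ∣tz′))
  where
  instance _ = prime⇒nonZero pr
  pᵉ∣tz′ : p ^ e ∣ t ℕ.* z′
  pᵉ∣tz′ = ℕD.*-cancelˡ-∣ p (subst (p ^ suc e ∣_) (trans (sym (ℕP.*-assoc t z′ p)) (ℕP.*-comm (t ℕ.* z′) p)) pᵉ⁺¹∣tz)

prime^e-cancelˡℤ : ∀ {p} e t {z} → Prime p → ¬ (+ p ∣ℤ t) → + (p ^ e) ∣ℤ t * z → + (p ^ e) ∣ℤ z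
prime^e-cancelˡℤ e t {z} pr p∤t pᵉ∣tz = ℤD.∣ᵤ⇒∣
  (prime^e-cancelˡ e pr (p∤t ∘ ℤD.∣ᵤ⇒∣) (subst (_ ∣_) (ℤP.abs-* t z) (ℤD.∣⇒∣ᵤ pᵉ∣tz)))

euclidsLemmaℤ : ∀ s t {p} → Prime p → + p ∣ℤ s * t → + p ∣ℤ s ⊎ + p ∣ℤ t
euclidsLemmaℤ s t pr p∣st =
  Sum.map ℤD.∣ᵤ⇒∣ ℤD.∣ᵤ⇒∣ (euclidsLemma _ _ pr (subst (_ ∣_) (ℤP.abs-* s t) (ℤD.∣⇒∣ᵤ p∣st)))

*-pres-∣ℤ : ∀ {i j m n} → i ∣ℤ m → j ∣ℤ n → i * j ∣ℤ m * n
*-pres-∣ℤ {i} {j} (divides q refl) (divides q′ refl) = divides (q * q′) (interchange q i q′ j)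
  where
  interchange : ∀ q i q′ j → q * i * (q′ * j) ≡ q * q′ * (i * j)
  interchange = solve-∀

prime⇒coprime-nondivisor : ∀ {p n} → Prime p → ¬ p ∣ n → Coprime p n
prime⇒coprime-nondivisor pr p∤n (d∣p , d∣n) with prime⇒irreducible pr d∣p
... | inj₁ d≡1 = d≡1
... | inj₂ refl = contradiction d∣n p∤n

mod-inverse : ∀ {p n} → Prime p → ¬ p ∣ n → ∃ λ B → + p ∣ℤ + n * B - + 1
mod-inverse {p} {n} pr p∤n with coprime-Bézout (prime⇒coprime-nondivisor pr p∤n)
... | Bézout.+- x y eq = - + y , divides (- + x) (begin
  + n * - + y - + 1     ≡⟨ rearrange (+ n) (+ y) ⟩
  - (+ 1 + + y * + n)   ≡⟨ cong -_ 1+yn≡xp ⟩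
  - (+ x * + p)         ≡⟨ ℤP.neg-distribˡ-* (+ x) (+ p) ⟩
  - + x * + p           ∎)
  where
  open ≡-Reasoning
  1+yn≡xp : + 1 + + y * + n ≡ + x * + p
  1+yn≡xp = begin
    + 1 + + y * + n         ≡⟨ cong (λ t → + 1 + t) (ℤP.pos-* y n) ⟨
    + 1 + + (y ℕ.* n)       ≡⟨ ℤP.pos-+ 1 (y ℕ.* n) ⟨
    + (1 ℕ.+ y ℕ.* n)       ≡⟨ cong +_ eq ⟩
    + (x ℕ.* p)             ≡⟨ ℤP.pos-* x p ⟩
    + x * + p               ∎
  rearrange : ∀ n y → n * - y - + 1 ≡ - (+ 1 + y * n)
  rearrange = solve-∀
... | Bézout.-+ x y eq = + y , divides (+ x) (begin
  + n * + y - + 1         ≡⟨ cong (_- + 1) (ℤP.*-comm (+ n) (+ y)) ⟩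
  + y * + n - + 1         ≡⟨ cong (_- + 1) (trans (sym (ℤP.pos-* y n)) (cong +_ (sym eq))) ⟩
  + (1 ℕ.+ x ℕ.* p) - + 1 ≡⟨ cong (_- + 1) (ℤP.pos-+ 1 (x ℕ.* p)) ⟩
  + 1 + + (x ℕ.* p) - + 1 ≡⟨ cancel (+ (x ℕ.* p)) ⟩
  + (x ℕ.* p)             ≡⟨ ℤP.pos-* x p ⟩
  + x * + p               ∎)
  where
  open ≡-Reasoning
  cancel : ∀ q → + 1 + q - + 1 ≡ q
  cancel = solve-∀

mod-inverseℤ : ∀ {p} β → Prime p → ¬ (+ p ∣ℤ β) → ∃ λ B → + p ∣ℤ β * B - + 1
mod-inverseℤ (+ n)    pr p∤β = mod-inverse pr (p∤β ∘ ℤD.∣ᵤ⇒∣)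
mod-inverseℤ -[1+ n ] pr p∤β with mod-inverse {n = suc n} pr (p∤β ∘ ℤD.∣ᵤ⇒∣)
... | B , p∣nB-1 = - B , subst (λ t → _ ∣ℤ t - + 1) (neg*neg (+ suc n) B) p∣nB-1
  where
  neg*neg : ∀ x y → x * y ≡ (- x) * (- y)
  neg*neg = solve-∀

residue-unique : ∀ {p u v} → u ℕ.< p → v ℕ.< p → + p ∣ℤ + u - + v → u ≡ v
residue-unique {p} {u} {v} u<p v<p p∣u-v with ∣ + u - + v ∣ in eq
... | zero  = ℤP.+-injective (ℤP.i-j≡0⇒i≡j (+ u) (+ v) (ℤP.∣i∣≡0⇒i≡0 eq))
... | suc d = contradiction (ℕD.∣⇒≤ (subst (p ∣_) eq (ℤD.∣⇒∣ᵤ p∣u-v))) (ℕP.<⇒≱ d<p)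
  where
  d<p : suc d ℕ.< p
  d<p = ℕP.≤-<-trans
    (subst (ℕ._≤ u ℕ.⊔ v) (trans (cong ∣_∣ (sym (ℤP.m-n≡m⊖n u v))) eq) (ℤP.∣m⊝n∣≤m⊔n u v))
    (ℕP.⊔-lub u<p v<p)

i≡j+k⇒i-k≡j : ∀ {i} j k → i ≡ j + k → i - k ≡ j
i≡j+k⇒i-k≡j j k refl = cancel j k
  where
  cancel : ∀ q d → q + d - d ≡ q
  cancel = solve-∀

complementary-residue : ∀ {d x y c} → d ∣ℤ x + y → d ∣ℤ x - c → d ∣ℤ y - (d - c)
complementary-residue {d} {x} {y} {c} d∣x+y d∣x-c =
  subst (_ ∣ℤ_) (rearrange x y c d) (ℤD.∣m∣n⇒∣m-n (ℤD.∣m∣n⇒∣m-n d∣x+y d∣x-c) (ℤD.∣-refl {d}))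
  where
  rearrange : ∀ x y c d → x + y - (x - c) - d ≡ y - (d - c)
  rearrange = solve-∀

mod-4-cases : ∀ u → ∃ λ q → u ≡ q * + 4 ⊎ u ≡ q * + 4 + + 1 ⊎ u ≡ q * + 4 + + 2 ⊎ u ≡ q * + 4 + + 3
mod-4-cases u with u %ℕ 4 | n%ℕd<d u 4 | a≡a%ℕn+[a/ℕn]*n u 4
... | 0 | _ | eq = u /ℕ 4 , inj₁ (trans eq (ℤP.+-identityˡ _))
... | 1 | _ | eq = u /ℕ 4 , inj₂ (inj₁ (trans eq (ℤP.+-comm (+ 1) (u /ℕ 4 * + 4))))
... | 2 | _ | eq = u /ℕ 4 , inj₂ (inj₂ (inj₁ (trans eq (ℤP.+-comm (+ 2) (u /ℕ 4 * + 4)))))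
... | 3 | _ | eq = u /ℕ 4 , inj₂ (inj₂ (inj₂ (trans eq (ℤP.+-comm (+ 3) (u /ℕ 4 * + 4)))))
... | suc (suc (suc (suc _))) | ℕ.s≤s (ℕ.s≤s (ℕ.s≤s (ℕ.s≤s ()))) | _

odd-mod-4 : ∀ {u} → ¬ (+ 2 ∣ℤ u) → + 4 ∣ℤ u - + 1 ⊎ + 4 ∣ℤ u - + 3
odd-mod-4 {u} 2∤u with mod-4-cases u
... | q , inj₁ refl                = contradiction (divides (q * + 2) (twice q)) 2∤u
  where twice : ∀ q → q * + 4 ≡ q * + 2 * + 2
        twice = solve-∀
... | q , inj₂ (inj₁ refl)         = inj₁ (divides q (shift q))
  where shift : ∀ q → q * + 4 + + 1 - + 1 ≡ q * + 4
        shift = solve-∀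
... | q , inj₂ (inj₂ (inj₁ refl))  = contradiction (divides (q * + 2 + + 1) (twice q)) 2∤u
  where twice : ∀ q → q * + 4 + + 2 ≡ (q * + 2 + + 1) * + 2
        twice = solve-∀
... | q , inj₂ (inj₂ (inj₂ refl))  = inj₂ (divides q (shift q))
  where shift : ∀ q → q * + 4 + + 3 - + 3 ≡ q * + 4
        shift = solve-∀

odd⇒2∣u-1 : ∀ {u} → ¬ (+ 2 ∣ℤ u) → + 2 ∣ℤ u - + 1
odd⇒2∣u-1 {u} 2∤u with odd-mod-4 2∤u
... | inj₁ 4∣u-1 = ℤD.∣-trans (divides (+ 2) refl) 4∣u-1
... | inj₂ 4∣u-3 = subst (_ ∣ℤ_) (shift u) (ℤD.∣m∣n⇒∣m+n (ℤD.∣-trans (divides (+ 2) refl) 4∣u-3) (ℤD.∣-refl {+ 2}))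
  where shift : ∀ u → u - + 3 + + 2 ≡ u - + 1
        shift = solve-∀

2∤2w+1 : ∀ w → ¬ (+ 2 ∣ℤ + 2 * w + + 1)
2∤2w+1 w 2∣2w+1 with ℕD.∣1⇒≡1 (ℤD.∣⇒∣ᵤ (ℤD.∣m+n∣m⇒∣n 2∣2w+1 (divides w (ℤP.*-comm (+ 2) w))))
... | ()

2∥x∧2∥y⇒4∣x+y : ∀ {x y} → + 2 ∣ℤ x → ¬ (+ 4 ∣ℤ x) → + 2 ∣ℤ y → ¬ (+ 4 ∣ℤ y) → + 4 ∣ℤ x + y
2∥x∧2∥y⇒4∣x+y (divides s refl) 4∤x (divides s′ refl) 4∤y
  with odd⇒2∣u-1 {s} (4∤x ∘ ℤD.*-monoˡ-∣ (+ 2)) | odd⇒2∣u-1 {s′} (4∤y ∘ ℤD.*-monoˡ-∣ (+ 2))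
... | divides t s-1≡ | divides t′ s′-1≡ = divides (t + t′ + + 1) (begin
  s * + 2 + s′ * + 2                   ≡⟨ recentre s s′ ⟩
  (s - + 1 + (s′ - + 1) + + 2) * + 2   ≡⟨ cong₂ (λ e e′ → (e + e′ + + 2) * + 2) s-1≡ s′-1≡ ⟩
  (t * + 2 + t′ * + 2 + + 2) * + 2     ≡⟨ collect t t′ ⟩
  (t + t′ + + 1) * + 4                 ∎)
  where
  open ≡-Reasoning
  recentre : ∀ s s′ → s * + 2 + s′ * + 2 ≡ (s - + 1 + (s′ - + 1) + + 2) * + 2
  recentre = solve-∀
  collect : ∀ t t′ → (t * + 2 + t′ * + 2 + + 2) * + 2 ≡ (t + t′ + + 1) * + 4
  collect = solve-∀

m-2≡2*odd : ∀ {m} → 4 ∣ m → 3 ℕ.≤ m → ∃ λ o → m ∸ 2 ≡ 2 ℕ.* (2 ℕ.* o ℕ.+ 1)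
m-2≡2*odd (ℕD.divides zero    refl) ()
m-2≡2*odd (ℕD.divides (suc q) refl) _ = q , expand q
  where
  expand : ∀ q → 2 ℕ.+ q ℕ.* 4 ≡ 2 ℕ.* (2 ℕ.* q ℕ.+ 1)
  expand = solveℕ

-- Shifted polygonal numbers

2∣n*[1+n] : ∀ n → 2 ∣ n ℕ.* suc n
2∣n*[1+n] zero    = 2 ℕD.∣0
2∣n*[1+n] (suc n) = subst (2 ∣_) (expand n) (ℕD.∣m∣n⇒∣m+n (2∣n*[1+n] n) (ℕD.m∣m*n (suc n)))
  where
  expand : ∀ n → n ℕ.* suc n ℕ.+ 2 ℕ.* suc n ≡ suc n ℕ.* suc (suc n)
  expand = solveℕ

double-half : ∀ {t} → 2 ∣ t → + 2 * + (t / 2) ≡ + t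
double-half {t} 2∣t = trans (sym (ℤP.pos-* 2 (t / 2))) (cong +_ (m*[n/m]≡n 2∣t))

double-tri : ∀ x → + 2 * tri x ≡ x * (x - + 1)
double-tri (+ zero)  = refl
double-tri (+ suc k) = begin
  + 2 * + ((suc k ℕ.* k) / 2) ≡⟨ double-half (subst (2 ∣_) (ℕP.*-comm k (suc k)) (2∣n*[1+n] k)) ⟩
  + (suc k ℕ.* k)             ≡⟨ ℤP.pos-* (suc k) k ⟩
  + suc k * (+ suc k - + 1)   ∎
  where open ≡-Reasoning
double-tri -[1+ n ]  = begin
  + 2 * + ((suc n ℕ.* suc (suc n)) / 2) ≡⟨ double-half (2∣n*[1+n] (suc n)) ⟩
  + (suc n ℕ.* suc (suc n))             ≡⟨ ℤP.pos-* (suc n) (suc (suc n)) ⟩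
  -[1+ n ] * -[1+ suc n ]               ≡⟨ cong (λ k → -[1+ n ] * -[1+ suc k ]) (ℕP.+-identityʳ n) ⟨
  -[1+ n ] * (-[1+ n ] - + 1)           ∎
  where open ≡-Reasoning

double-P : ∀ m r x → + 2 * P m r x ≡ + (m ∸ 2) * (x * (x - + 1)) + + 2 * + r * x
double-P m r x = begin
  + 2 * (+ (m ∸ 2) * tri x + + r * x)       ≡⟨ regroup (+ (m ∸ 2)) (tri x) (+ r) x ⟩
  + (m ∸ 2) * (+ 2 * tri x) + + 2 * + r * x ≡⟨ cong (λ t → + (m ∸ 2) * t + + 2 * + r * x) (double-tri x) ⟩
  + (m ∸ 2) * (x * (x - + 1)) + + 2 * + r * x ∎
  where
  open ≡-Reasoning
  regroup : ∀ d t r x → + 2 * (d * t + r * x) ≡ d * (+ 2 * t) + + 2 * r * x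
  regroup = solve-∀

-- The derivative of 2 P_m^{(r)}.
slope : ℕ → ℕ → ℤ → ℤ
slope m r w = + 2 * + (m ∸ 2) * w - (+ (m ∸ 2) - + 2 * + r)

double-P-taylor : ∀ m r w d →
  + 2 * P m r (w + d) ≡ + (m ∸ 2) * d * d + slope m r w * d + + 2 * P m r w
double-P-taylor m r w d = begin
  + 2 * P m r (w + d)                                               ≡⟨ double-P m r (w + d) ⟩
  D * ((w + d) * (w + d - + 1)) + + 2 * + r * (w + d)              ≡⟨ expand D (+ r) w d ⟩
  D * d * d + slope m r w * d + (D * (w * (w - + 1)) + + 2 * + r * w) ≡⟨ cong (λ t → D * d * d + slope m r w * d + t) (double-P m r w) ⟨
  D * d * d + slope m r w * d + + 2 * P m r w                       ∎
  where
  open ≡-Reasoning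
  D = + (m ∸ 2)
  expand : ∀ D r w d → D * ((w + d) * (w + d - + 1)) + + 2 * r * (w + d)
                     ≡ D * d * d + (+ 2 * D * w - (D - + 2 * r)) * d + (D * (w * (w - + 1)) + + 2 * r * w)
  expand = solve-∀

P-λ-substitution : ∀ m r r′ (p j y : ℤ) →
  + 2 * p * + r′ ≡ + (m ∸ 2) * (p + + 2 * j) - (+ (m ∸ 2) - + 2 * + r) →
  P m r (j + y * p) ≡ p * p * P m r′ y + P m r j
P-λ-substitution m r r′ p j y level = ℤP.*-cancelˡ-≡ (+ 2) _ _ (begin
  + 2 * P m r (j + y * p)                                      ≡⟨ double-P-taylor m r j (y * p) ⟩
  D * (y * p) * (y * p) + slope m r j * (y * p) + + 2 * P m r j ≡⟨ cong (λ s → D * (y * p) * (y * p) + s * (y * p) + + 2 * P m r j) slope≡ ⟩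
  D * (y * p) * (y * p) + (+ 2 * p * + r′ - D * p) * (y * p) + + 2 * P m r j ≡⟨ regroup D (+ r′) p y (+ 2 * P m r j) ⟩
  p * p * (D * (y * (y - + 1)) + + 2 * + r′ * y) + + 2 * P m r j ≡⟨ cong (λ t → p * p * t + + 2 * P m r j) (double-P m r′ y) ⟨
  p * p * (+ 2 * P m r′ y) + + 2 * P m r j                     ≡⟨ factor (p * p) (P m r′ y) (P m r j) ⟩
  + 2 * (p * p * P m r′ y + P m r j)                           ∎)
  where
  open ≡-Reasoning
  D = + (m ∸ 2)
  slope≡ : slope m r j ≡ + 2 * p * + r′ - D * p
  slope≡ = begin
    slope m r j                              ≡⟨ rearrange D p j (+ r) ⟩
    (D * (p + + 2 * j) - (D - + 2 * + r)) - D * p ≡⟨ cong (_- D * p) level ⟨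
    + 2 * p * + r′ - D * p                   ∎
    where
    rearrange : ∀ D p j r → + 2 * D * j - (D - + 2 * r) ≡ (D * (p + + 2 * j) - (D - + 2 * r)) - D * p
    rearrange = solve-∀
  regroup : ∀ D r′ p y c → D * (y * p) * (y * p) + (+ 2 * p * r′ - D * p) * (y * p) + c
                         ≡ p * p * (D * (y * (y - + 1)) + + 2 * r′ * y) + c
  regroup = solve-∀
  factor : ∀ q s t → q * (+ 2 * s) + + 2 * t ≡ + 2 * (q * s + t)
  factor = solve-∀

P-ℕ : ∀ m r x → ∃ λ c → P m r (+ x) ≡ + c
P-ℕ m r x = D ℕ.* t ℕ.+ r ℕ.* x , (begin
  + D * + t + + r * + x           ≡⟨ cong₂ _+_ (ℤP.pos-* D t) (ℤP.pos-* r x) ⟨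
  + (D ℕ.* t) + + (r ℕ.* x)       ≡⟨ ℤP.pos-+ (D ℕ.* t) (r ℕ.* x) ⟨
  + (D ℕ.* t ℕ.+ r ℕ.* x)         ∎)
  where
  open ≡-Reasoning
  D = m ∸ 2
  t = (x ℕ.* (x ∸ 1)) / 2

evalΔ-ℕ : ∀ m n (a r x : Fin n → ℕ) → ∃ λ c → evalΔ m n a r (λ i → + x i) ≡ + c
evalΔ-ℕ m n a r x = sumℤ-ℕ _ λ i →
  a i ℕ.* proj₁ (P-ℕ m (r i) (x i)) ,
  trans (cong (+ a i *_) (proj₂ (P-ℕ m (r i) (x i)))) (sym (ℤP.pos-* (a i) _))

-- The derivative of 2Δ at w in the direction v.
derivΔ : (m : ℕ) {n : ℕ} → (a r : Fin n → ℕ) → (w v : Fin n → ℤ) → ℤ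
derivΔ m a r w v = sumℤ (λ i → + a i * slope m (r i) (w i) * v i)

double-Δ-line : ∀ m n (a r : Fin n → ℕ) (w v : Fin n → ℤ) l →
  + 2 * evalΔ m n a r (λ i → w i + l * v i)
    ≡ + (m ∸ 2) * Qa a v v * l * l + derivΔ m a r w v * l + + 2 * evalΔ m n a r w
double-Δ-line m n a r w v l = begin
  + 2 * evalΔ m n a r (λ i → w i + l * v i)                ≡⟨ *-distribˡ-sumℤ {n} (+ 2) _ ⟩
  sumℤ (λ i → + 2 * (+ a i * P m (r i) (w i + l * v i)))   ≡⟨ sumℤ-cong {n} term ⟩
  sumℤ (λ i → c₁ * (+ a i * v i * v i) + l * (+ a i * slope m (r i) (w i) * v i) + + 2 * (+ a i * P m (r i) (w i)))
    ≡⟨ trans (sumℤ-distrib-+ {n} _ _) (cong₂ _+_ (sumℤ-distrib-+ {n} _ _) refl) ⟩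
  sumℤ (λ i → c₁ * (+ a i * v i * v i)) + sumℤ (λ i → l * (+ a i * slope m (r i) (w i) * v i))
    + sumℤ (λ i → + 2 * (+ a i * P m (r i) (w i)))
    ≡⟨ cong₂ _+_ (cong₂ _+_ (*-distribˡ-sumℤ {n} c₁ _) (*-distribˡ-sumℤ {n} l _)) (*-distribˡ-sumℤ {n} (+ 2) _) ⟨
  c₁ * Qa a v v + l * derivΔ m a r w v + + 2 * evalΔ m n a r w
    ≡⟨ reorder (+ (m ∸ 2)) (Qa a v v) (derivΔ m a r w v) l (+ 2 * evalΔ m n a r w) ⟩
  + (m ∸ 2) * Qa a v v * l * l + derivΔ m a r w v * l + + 2 * evalΔ m n a r w ∎
  where
  open ≡-Reasoning
  c₁ = + (m ∸ 2) * l * l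
  term : ∀ i → + 2 * (+ a i * P m (r i) (w i + l * v i))
             ≡ c₁ * (+ a i * v i * v i) + l * (+ a i * slope m (r i) (w i) * v i) + + 2 * (+ a i * P m (r i) (w i))
  term i = begin
    + 2 * (+ a i * P m (r i) (w i + l * v i))  ≡⟨ swap (+ a i) (P m (r i) (w i + l * v i)) ⟩
    + a i * (+ 2 * P m (r i) (w i + l * v i))  ≡⟨ cong (+ a i *_) (double-P-taylor m (r i) (w i) (l * v i)) ⟩
    + a i * (+ (m ∸ 2) * (l * v i) * (l * v i) + slope m (r i) (w i) * (l * v i) + + 2 * P m (r i) (w i))
      ≡⟨ distribute (+ a i) (+ (m ∸ 2)) (v i) l (slope m (r i) (w i)) (P m (r i) (w i)) ⟩
    c₁ * (+ a i * v i * v i) + l * (+ a i * slope m (r i) (w i) * v i) + + 2 * (+ a i * P m (r i) (w i)) ∎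
    where
    swap : ∀ a t → + 2 * (a * t) ≡ a * (+ 2 * t)
    swap = solve-∀
    distribute : ∀ a D v l s q → a * (D * (l * v) * (l * v) + s * (l * v) + + 2 * q)
                               ≡ D * l * l * (a * v * v) + l * (a * s * v) + + 2 * (a * q)
    distribute = solve-∀
  reorder : ∀ D Q d l e → D * l * l * Q + l * d + e ≡ D * Q * l * l + d * l + e
  reorder = solve-∀

derivΔ-shift : ∀ m {n} (a r : Fin n → ℕ) w v d →
  derivΔ m a r (λ i → w i + δ d i) v ≡ derivΔ m a r w v + + 2 * + (m ∸ 2) * (+ a d * v d)
derivΔ-shift m {n} a r w v d = begin
  derivΔ m a r (λ i → w i + δ d i) v                               ≡⟨ sumℤ-cong (λ i → shift (+ a i) (+ (m ∸ 2)) (+ r i) (w i) (δ d i) (v i)) ⟩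
  sumℤ (λ i → + a i * slope m (r i) (w i) * v i + c * (δ d i * (+ a i * v i))) ≡⟨ sumℤ-distrib-+ {n} _ _ ⟩
  derivΔ m a r w v + sumℤ (λ i → c * (δ d i * (+ a i * v i)))      ≡⟨ cong (λ t → derivΔ m a r w v + t) (*-distribˡ-sumℤ {n} c _) ⟨
  derivΔ m a r w v + c * sumℤ (λ i → δ d i * (+ a i * v i))        ≡⟨ cong (λ t → derivΔ m a r w v + c * t) (sumℤ-δ d (λ i → + a i * v i)) ⟩
  derivΔ m a r w v + c * (+ a d * v d)                             ∎
  where
  open ≡-Reasoning
  c = + 2 * + (m ∸ 2)
  shift : ∀ a D r w δ v → a * (+ 2 * D * (w + δ) - (D - + 2 * r)) * v
                        ≡ a * (+ 2 * D * w - (D - + 2 * r)) * v + + 2 * D * (δ * (a * v))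
  shift = solve-∀

-- The diagonal form ⟨a_1, …, a_n⟩

Qa-sym : ∀ {n} (a : Fin n → ℕ) u v → Qa a u v ≡ Qa a v u
Qa-sym a u v = sumℤ-cong λ i → swap (+ a i) (u i) (v i)
  where
  swap : ∀ a u v → a * u * v ≡ a * v * u
  swap = solve-∀

Qa-+ʳ : ∀ {n} (a : Fin n → ℕ) u v w → Qa a u (λ i → v i + w i) ≡ Qa a u v + Qa a u w
Qa-+ʳ {n} a u v w = trans (sumℤ-cong λ i → ℤP.*-distribˡ-+ (+ a i * u i) (v i) (w i)) (sumℤ-distrib-+ {n} _ _)

Qa-+ˡ : ∀ {n} (a : Fin n → ℕ) u v w → Qa a (λ i → u i + v i) w ≡ Qa a u w + Qa a v w
Qa-+ˡ a u v w = begin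
  Qa a (λ i → u i + v i) w    ≡⟨ Qa-sym a _ w ⟩
  Qa a w (λ i → u i + v i)    ≡⟨ Qa-+ʳ a w u v ⟩
  Qa a w u + Qa a w v         ≡⟨ cong₂ _+_ (Qa-sym a w u) (Qa-sym a w v) ⟩
  Qa a u w + Qa a v w         ∎
  where open ≡-Reasoning

Qa-expand : ∀ {n} (a : Fin n → ℕ) u v →
  Qa a (λ i → u i + v i) (λ i → u i + v i) ≡ Qa a u u + + 2 * Qa a u v + Qa a v v
Qa-expand a u v = begin
  Qa a (λ i → u i + v i) (λ i → u i + v i)                 ≡⟨ Qa-+ˡ a u v _ ⟩
  Qa a u (λ i → u i + v i) + Qa a v (λ i → u i + v i)      ≡⟨ cong₂ _+_ (Qa-+ʳ a u u v) (Qa-+ʳ a v u v) ⟩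
  Qa a u u + Qa a u v + (Qa a v u + Qa a v v)              ≡⟨ cong (λ t → Qa a u u + Qa a u v + (t + Qa a v v)) (Qa-sym a v u) ⟩
  Qa a u u + Qa a u v + (Qa a u v + Qa a v v)              ≡⟨ collect (Qa a u u) (Qa a u v) (Qa a v v) ⟩
  Qa a u u + + 2 * Qa a u v + Qa a v v                     ∎
  where
  open ≡-Reasoning
  collect : ∀ x y z → x + y + (y + z) ≡ x + + 2 * y + z
  collect = solve-∀

Qa-δˡ : ∀ {n} (a : Fin n → ℕ) c d w → Qa a (λ i → c * δ d i) w ≡ c * (+ a d * w d)
Qa-δˡ {n} a c d w = begin
  Qa a (λ i → c * δ d i) w                     ≡⟨ sumℤ-cong (λ i → regroup (+ a i) c (δ d i) (w i)) ⟩
  sumℤ (λ i → c * (δ d i * (+ a i * w i)))     ≡⟨ *-distribˡ-sumℤ {n} c _ ⟨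
  c * sumℤ (λ i → δ d i * (+ a i * w i))       ≡⟨ cong (c *_) (sumℤ-δ d (λ i → + a i * w i)) ⟩
  c * (+ a d * w d)                            ∎
  where
  open ≡-Reasoning
  regroup : ∀ a c δ w → a * (c * δ) * w ≡ c * (δ * (a * w))
  regroup = solve-∀

-- p-adic solutions

ℤp-from : ∀ {p} (s : ℕ → ℤ) → (∀ k → + (p ^ k) ∣ℤ s (suc k) - s k) → ℤp p
ℤp-from s coh = record { seq = s ; coh = ℤD.∣⇒∣ᵤ ∘ coh }

∣x-x : ∀ d x → d ℤU.∣ x - x
∣x-x d x = subst (d ℤU.∣_) (sym (ℤP.+-inverseʳ x)) (∣ d ∣ ℕD.∣0)

const : ∀ {p} → ℤ → ℤp p
const {p} z = record { seq = λ _ → z ; coh = λ k → ∣x-x (+ (p ^ k)) z }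

affine : ∀ {p} (c d : ℤ) → ℤp p → ℤp p
affine c d y = ℤp-from (λ k → c + seq y k * d) (λ k →
  subst (_ ∣ℤ_) (difference c (seq y (suc k)) (seq y k) d) (ℤD.∣m⇒∣m*n {m = seq y (suc k) - seq y k} d (ℤD.∣ᵤ⇒∣ (coh y k))))
  where
  difference : ∀ c y y′ d → (y - y′) * d ≡ c + y * d - (c + y′ * d)
  difference = solve-∀

-- Since p ∣ α and B inverts β mod p, the Newton correction −B (G y − T) gains one p-adic digit per step.
module Newton {p : ℕ} {α β B : ℤ} (p∣α : + p ∣ℤ α) (βB≡1 : + p ∣ℤ β * B - + 1) (T : ℤp p) where

  G : ℤ → ℤ
  G y = α * y * y + β * y

  approx : ℕ → ℤ
  approx zero    = + 0
  approx (suc j) = approx j - B * (G (approx j) - seq T (suc j))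

  approx-error : ∀ j → + (p ^ j) ∣ℤ G (approx j) - seq T j

  error-ahead : ∀ j → + (p ^ j) ∣ℤ G (approx j) - seq T (suc j)
  error-ahead j = subst (_ ∣ℤ_) (telescope (G (approx j)) (seq T j) (seq T (suc j)))
    (ℤD.∣m∣n⇒∣m-n (approx-error j) (ℤD.∣ᵤ⇒∣ (coh T j)))
    where
    telescope : ∀ g t t′ → (g - t) - (t′ - t) ≡ g - t′
    telescope = solve-∀

  approx-error zero    = divides (G (+ 0) - seq T 0) (sym (ℤP.*-identityʳ _))
  approx-error (suc j) with error-ahead j
  ... | divides e E≡ = divides
    (α′ * B * B * e * e * + (p ^ j) - + 2 * α′ * approx j * B * e - u * e) (begin
    G (approx j - B * E) - seq T (suc j)                        ≡⟨ newton-step α β B (approx j) (seq T (suc j)) ⟩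
    α * B * B * E * E - + 2 * α * approx j * B * E - (β * B - + 1) * E
      ≡⟨ cong (λ X → α * B * B * X * X - + 2 * α * approx j * B * X - (β * B - + 1) * X) E≡ ⟩
    α * B * B * (e * + (p ^ j)) * (e * + (p ^ j)) - + 2 * α * approx j * B * (e * + (p ^ j)) - (β * B - + 1) * (e * + (p ^ j))
      ≡⟨ cong₂ (λ A U → A * B * B * (e * + (p ^ j)) * (e * + (p ^ j)) - + 2 * A * approx j * B * (e * + (p ^ j)) - U * (e * + (p ^ j)))
               (ℤD._∣_.equality p∣α) (ℤD._∣_.equality βB≡1) ⟩
    α′ * + p * B * B * (e * + (p ^ j)) * (e * + (p ^ j)) - + 2 * (α′ * + p) * approx j * B * (e * + (p ^ j)) - u * + p * (e * + (p ^ j))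
      ≡⟨ collect α′ (+ p) B e (+ (p ^ j)) (approx j) u ⟩
    (α′ * B * B * e * e * + (p ^ j) - + 2 * α′ * approx j * B * e - u * e) * (+ p * + (p ^ j))
      ≡⟨ cong (λ t → (α′ * B * B * e * e * + (p ^ j) - + 2 * α′ * approx j * B * e - u * e) * t) (ℤP.pos-* p (p ^ j)) ⟨
    (α′ * B * B * e * e * + (p ^ j) - + 2 * α′ * approx j * B * e - u * e) * + (p ^ suc j) ∎)
    where
    open ≡-Reasoning
    α′ = ℤD._∣_.quotient p∣α
    u  = ℤD._∣_.quotient βB≡1
    E  = G (approx j) - seq T (suc j)
    newton-step : ∀ α β B y t → let E = α * y * y + β * y - t in
      α * (y - B * E) * (y - B * E) + β * (y - B * E) - t
        ≡ α * B * B * E * E - + 2 * α * y * B * E - (β * B - + 1) * E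
    newton-step = solve-∀
    collect : ∀ α′ q B e s y u →
      α′ * q * B * B * (e * s) * (e * s) - + 2 * (α′ * q) * y * B * (e * s) - u * q * (e * s)
        ≡ (α′ * B * B * e * e * s - + 2 * α′ * y * B * e - u * e) * (q * s)
    collect = solve-∀

  approx-coherent : ∀ j → + (p ^ j) ∣ℤ approx (suc j) - approx j
  approx-coherent j = subst (_ ∣ℤ_) (correction (approx j) B _) (ℤD.∣m⇒∣-m (ℤD.∣n⇒∣m*n B (error-ahead j)))
    where
    correction : ∀ y B E → - (B * E) ≡ y - B * E - y
    correction = solve-∀

hensel-quadratic : ∀ {p α} β → + p ∣ℤ α → (∃ λ B → + p ∣ℤ β * B - + 1) → (T : ℤp p) →
  ∃ λ (y : ℤp p) → ∀ j → + (p ^ j) ∣ℤ α * seq y j * seq y j + β * seq y j - seq T j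
hensel-quadratic β p∣α (B , βB≡1) T = ℤp-from approx approx-coherent , approx-error
  where open Newton {β = β} {B} p∣α βB≡1 T

ZpUniversal-from-line : ∀ m n (a r : Fin n → ℕ) {p} → Prime p → ¬ (+ p ∣ℤ + 2) → (w v : Fin n → ℤ) →
  + p ∣ℤ + (m ∸ 2) * Qa a v v → ¬ (+ p ∣ℤ derivΔ m a r w v) → ZpUniversal m n a r p
ZpUniversal-from-line m n a r {p} pr p∤2 w v p∣α p∤β N = x , Δx→N
  where
  Δw = evalΔ m n a r w
  T : ℤp p
  T = ℤp-from (λ j → + 2 * seq N j - + 2 * Δw) λ j →
    subst (_ ∣ℤ_) (shift (seq N (suc j)) (seq N j) Δw) (ℤD.∣n⇒∣m*n (+ 2) (ℤD.∣ᵤ⇒∣ (coh N j)))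
    where
    shift : ∀ t t′ c → + 2 * (t - t′) ≡ (+ 2 * t - + 2 * c) - (+ 2 * t′ - + 2 * c)
    shift = solve-∀
  β = derivΔ m a r w v
  solution = hensel-quadratic β p∣α (mod-inverseℤ β pr p∤β) T
  y = proj₁ solution
  x : Fin n → ℤp p
  x i = affine (w i) (v i) y
  double-error : ∀ j → + 2 * (evalΔ m n a r (λ i → seq (x i) j) - seq N j)
    ≡ + (m ∸ 2) * Qa a v v * seq y j * seq y j + β * seq y j - seq T j
  double-error j = begin
    + 2 * (evalΔ m n a r (λ i → w i + seq y j * v i) - seq N j)       ≡⟨ distribute (evalΔ m n a r (λ i → w i + seq y j * v i)) (seq N j) ⟩
    + 2 * evalΔ m n a r (λ i → w i + seq y j * v i) - + 2 * seq N j  ≡⟨ cong (_- + 2 * seq N j) (double-Δ-line m n a r w v (seq y j)) ⟩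
    quadratic + + 2 * Δw - + 2 * seq N j                               ≡⟨ reassociate quadratic (+ 2 * Δw) (+ 2 * seq N j) ⟩
    quadratic - seq T j ∎
    where
    open ≡-Reasoning
    quadratic = + (m ∸ 2) * Qa a v v * seq y j * seq y j + β * seq y j
    distribute : ∀ e t → + 2 * (e - t) ≡ + 2 * e - + 2 * t
    distribute = solve-∀
    reassociate : ∀ g c t → g + c - t ≡ g - (t - c)
    reassociate = solve-∀
  Δx→N : LimEq p (λ j → evalΔ m n a r (λ i → seq (x i) j)) (seq N)
  Δx→N k = k , λ j k≤j → ℤD.∣⇒∣ᵤ (ℤD.∣-trans (ℤD.∣ᵤ⇒∣ {+ (p ^ k)} {+ (p ^ j)} (^-mono-∣ p k≤j))
    (prime^e-cancelˡℤ j (+ 2) pr p∤2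
      (subst (_ ∣ℤ_) (sym (double-error j)) (proj₂ solution j))))

-- Binary 2-adic sublattices

Represents⟨1,3⟩ : (n : ℕ) → (Fin n → ℕ) → Set
Represents⟨1,3⟩ n a = ∃ λ (u : ℤp 2) → ∃ λ (u′ : ℤp 2) →
  CongZp u (+ 1) 2 × CongZp u′ (+ 3) 2 × RepresentsBinary2 n a u u′

represents-orthogonal-pair : ∀ {n} (a : Fin n → ℕ) V W → Qa a V W ≡ + 0 →
  RepresentsBinary2 n a (const (Qa a V V)) (const (Qa a W W))
represents-orthogonal-pair a V W B≡0 =
  (λ i → const (V i)) , (λ i → const (W i)) , exact (Qa a V V) , exact (Qa a W W) ,
  λ k → 0 , λ j _ → subst (λ t → + (2 ^ k) ℤU.∣ t - + 0) (sym B≡0) ((2 ^ k) ℕD.∣0)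
  where
  exact : ∀ x → LimEq 2 (λ _ → x) (λ _ → x)
  exact x k = 0 , λ j _ → ∣x-x (+ (2 ^ k)) x

odd-orthogonal-pair⇒⟨1,3⟩ : ∀ {n} (a : Fin n → ℕ) V W → Qa a V W ≡ + 0 →
  ¬ (+ 2 ∣ℤ Qa a V V) → + 4 ∣ℤ Qa a V V + Qa a W W → Represents⟨1,3⟩ n a
odd-orthogonal-pair⇒⟨1,3⟩ a V W B≡0 2∤QV 4∣QV+QW with odd-mod-4 2∤QV
... | inj₁ QV≡1 = const (Qa a V V) , const (Qa a W W) , ℤD.∣⇒∣ᵤ QV≡1 , ℤD.∣⇒∣ᵤ (complementary-residue {x = Qa a V V} {Qa a W W} 4∣QV+QW QV≡1) ,
                  represents-orthogonal-pair a V W B≡0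
... | inj₂ QV≡3 = const (Qa a W W) , const (Qa a V V) , ℤD.∣⇒∣ᵤ (complementary-residue {x = Qa a V V} {Qa a W W} 4∣QV+QW QV≡3) , ℤD.∣⇒∣ᵤ QV≡3 ,
                  represents-orthogonal-pair a W V (trans (Qa-sym a W V) B≡0)

module CoordinateSplit {n} (a : Fin n → ℕ) (Z : Fin n → ℤ) (i₀ : Fin n)
                       (2∤aᵢ₀ : ¬ 2 ∣ a i₀) (2∤Zᵢ₀ : ¬ (+ 2 ∣ℤ Z i₀)) where

  V W₀ : Fin n → ℤ
  V  i = Z i₀ * δ i₀ i
  W₀ i = Z i - Z i₀ * δ i₀ i

  W₀-vanishes : W₀ i₀ ≡ + 0
  W₀-vanishes = trans (cong (λ t → Z i₀ - Z i₀ * t) (δ-refl i₀)) (cancel (Z i₀))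
    where
    cancel : ∀ z → z - z * + 1 ≡ + 0
    cancel = solve-∀

  V⊥ : ∀ u → u i₀ ≡ + 0 → Qa a V u ≡ + 0
  V⊥ u uᵢ₀≡0 = begin
    Qa a V u                  ≡⟨ Qa-δˡ a (Z i₀) i₀ u ⟩
    Z i₀ * (+ a i₀ * u i₀)    ≡⟨ cong (λ t → Z i₀ * (+ a i₀ * t)) uᵢ₀≡0 ⟩
    Z i₀ * (+ a i₀ * + 0)     ≡⟨ annihilate (Z i₀) (+ a i₀) ⟩
    + 0                       ∎
    where
    open ≡-Reasoning
    annihilate : ∀ z a → z * (a * + 0) ≡ + 0
    annihilate = solve-∀

  QV≡ : Qa a V V ≡ Z i₀ * (+ a i₀ * Z i₀)
  QV≡ = begin
    Qa a V V                            ≡⟨ Qa-δˡ a (Z i₀) i₀ V ⟩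
    Z i₀ * (+ a i₀ * (Z i₀ * δ i₀ i₀))  ≡⟨ cong (λ t → Z i₀ * (+ a i₀ * (Z i₀ * t))) (δ-refl i₀) ⟩
    Z i₀ * (+ a i₀ * (Z i₀ * + 1))      ≡⟨ cong (λ t → Z i₀ * (+ a i₀ * t)) (ℤP.*-identityʳ (Z i₀)) ⟩
    Z i₀ * (+ a i₀ * Z i₀)              ∎
    where open ≡-Reasoning

  QV-odd : ¬ (+ 2 ∣ℤ Qa a V V)
  QV-odd 2∣QV = Sum.[ 2∤Zᵢ₀ , (λ 2∣aZ → Sum.[ 2∤aᵢ₀ ∘ ℤD.∣⇒∣ᵤ , 2∤Zᵢ₀ ]′ (euclidsLemmaℤ (+ a i₀) (Z i₀) prime[2] 2∣aZ)) ]′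
    (euclidsLemmaℤ (Z i₀) (+ a i₀ * Z i₀) prime[2] (subst (+ 2 ∣ℤ_) QV≡ 2∣QV))

  Q-split : Qa a Z Z ≡ Qa a V V + Qa a W₀ W₀
  Q-split = begin
    Qa a Z Z                                           ≡⟨ sumℤ-cong (λ i → cong (λ z → + a i * z * z) (recombine (Z i) (Z i₀ * δ i₀ i))) ⟩
    Qa a (λ i → V i + W₀ i) (λ i → V i + W₀ i)         ≡⟨ Qa-expand a V W₀ ⟩
    Qa a V V + + 2 * Qa a V W₀ + Qa a W₀ W₀            ≡⟨ cong (λ t → Qa a V V + + 2 * t + Qa a W₀ W₀) (V⊥ W₀ W₀-vanishes) ⟩
    Qa a V V + + 2 * + 0 + Qa a W₀ W₀                  ≡⟨ cong (_+ Qa a W₀ W₀) (ℤP.+-identityʳ (Qa a V V)) ⟩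
    Qa a V V + Qa a W₀ W₀                              ∎
    where
    open ≡-Reasoning
    recombine : ∀ z v → z ≡ v + (z - v)
    recombine = solve-∀

  ⟨1,3⟩-if-4∣Q : + 4 ∣ℤ Qa a Z Z → Represents⟨1,3⟩ n a
  ⟨1,3⟩-if-4∣Q 4∣Q = odd-orthogonal-pair⇒⟨1,3⟩ a V W₀ (V⊥ W₀ W₀-vanishes) QV-odd (subst (_ ∣ℤ_) Q-split 4∣Q)

  -- Here Q(Z) ≡ 2 (mod 4), so the missing 2 is borrowed from a coordinate d with a_d ≡ 2 (mod 4).
  ⟨1,3⟩-if-2∥Q : + 2 ∣ℤ Qa a Z Z → ¬ (+ 4 ∣ℤ Qa a Z Z) → (d : Fin n) → 2 ∣ a d → ¬ 4 ∣ a d → Represents⟨1,3⟩ n a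
  ⟨1,3⟩-if-2∥Q 2∣Q 4∤Q d 2∣a 4∤a = odd-orthogonal-pair⇒⟨1,3⟩ a V W (V⊥ W Wᵢ₀≡0) QV-odd 4∣QV+QW
    where
    open ≡-Reasoning
    e W : Fin n → ℤ
    e i = + 1 * δ d i
    W i = W₀ i + e i

    Wᵢ₀≡0 : W i₀ ≡ + 0
    Wᵢ₀≡0 = cong₂ (λ w t → w + + 1 * t) W₀-vanishes (δ-≢ {d = d} {i₀} λ { refl → 2∤aᵢ₀ 2∣a })

    QW : Qa a W W ≡ Qa a W₀ W₀ + + a d * (+ 2 * W₀ d + + 1)
    QW = begin
      Qa a W W                                            ≡⟨ Qa-expand a W₀ e ⟩
      Qa a W₀ W₀ + + 2 * Qa a W₀ e + Qa a e e             ≡⟨ cong (λ t → Qa a W₀ W₀ + + 2 * t + Qa a e e) (Qa-sym a W₀ e) ⟩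
      Qa a W₀ W₀ + + 2 * Qa a e W₀ + Qa a e e             ≡⟨ cong₂ (λ s t → Qa a W₀ W₀ + + 2 * s + t) (Qa-δˡ a (+ 1) d W₀) (Qa-δˡ a (+ 1) d e) ⟩
      Qa a W₀ W₀ + + 2 * (+ 1 * (+ a d * W₀ d)) + + 1 * (+ a d * (+ 1 * δ d d))
        ≡⟨ cong (λ t → Qa a W₀ W₀ + + 2 * (+ 1 * (+ a d * W₀ d)) + + 1 * (+ a d * (+ 1 * t))) (δ-refl d) ⟩
      Qa a W₀ W₀ + + 2 * (+ 1 * (+ a d * W₀ d)) + + 1 * (+ a d * (+ 1 * + 1))
        ≡⟨ collect (Qa a W₀ W₀) (+ a d) (W₀ d) ⟩
      Qa a W₀ W₀ + + a d * (+ 2 * W₀ d + + 1)             ∎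
      where
      collect : ∀ q a w → q + + 2 * (+ 1 * (a * w)) + + 1 * (a * (+ 1 * + 1)) ≡ q + a * (+ 2 * w + + 1)
      collect = solve-∀

    4∣QV+QW : + 4 ∣ℤ Qa a V V + Qa a W W
    4∣QV+QW = subst (_ ∣ℤ_) sum≡ (2∥x∧2∥y⇒4∣x+y 2∣Q 4∤Q 2∣ad 4∤ad)
      where
      t = + 2 * W₀ d + + 1
      2∣ad : + 2 ∣ℤ + a d * t
      2∣ad = ℤD.∣m⇒∣m*n {m = + a d} t (ℤD.∣ᵤ⇒∣ 2∣a)
      4∤ad : ¬ (+ 4 ∣ℤ + a d * t)
      4∤ad 4∣ = 4∤a (ℤD.∣⇒∣ᵤ (prime^e-cancelˡℤ 2 t prime[2] (2∤2w+1 (W₀ d)) (subst (_ ∣ℤ_) (ℤP.*-comm (+ a d) t) 4∣)))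
      sum≡ : Qa a Z Z + + a d * t ≡ Qa a V V + Qa a W W
      sum≡ = begin
        Qa a Z Z + + a d * t                       ≡⟨ cong (_+ + a d * t) Q-split ⟩
        Qa a V V + Qa a W₀ W₀ + + a d * t          ≡⟨ ℤP.+-assoc (Qa a V V) _ _ ⟩
        Qa a V V + (Qa a W₀ W₀ + + a d * t)        ≡⟨ cong (λ q → Qa a V V + q) QW ⟨
        Qa a V V + Qa a W W                        ∎

-- The λ_p-transformation

module LambdaStep (m n : ℕ) (a r b r′ : Fin n → ℕ) {p : ℕ} (pr : Prime p) (L : IsLambda m n a r p b r′) where
  open IsLambda L public

  instance
    p≢0 : NonZero p
    p≢0 = prime⇒nonZero pr

  digitᵈ : ∀ i → Dec (p ∣ a i) → ℕ
  digitᵈ i (yes _)    = 0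
  digitᵈ i (no p∤aᵢ)  = proj₁ (proj₂ (ndiv-coeff i p∤aᵢ))

  scaleᵈ : ∀ {i} → Dec (p ∣ a i) → ℕ
  scaleᵈ (yes _) = 1
  scaleᵈ (no _)  = p

  lowerᵈ : ∀ {i} → Dec (p ∣ a i) → ℕ → ℕ
  lowerᵈ (yes _) x = x
  lowerᵈ (no _)  x = x / p

  digit : Fin n → ℕ
  digit i = digitᵈ i (p ℕD.∣? a i)

  lift : Fin n → ℤ → ℤ
  lift i y = + digit i + y * + scaleᵈ (p ℕD.∣? a i)

  pᵏbᵢ≡p²aᵢ : ∀ i → ¬ p ∣ a i → + (p ^ k) * + b i ≡ + p * + p * + a i
  pᵏbᵢ≡p²aᵢ i p∤aᵢ = begin
    + (p ^ k) * + b i                  ≡⟨ cong (λ c → + (p ^ k) * + c) (proj₁ (ndiv-coeff i p∤aᵢ)) ⟩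
    + (p ^ k) * + (p ^ (2 ∸ k) ℕ.* a i) ≡⟨ ℤP.pos-* (p ^ k) _ ⟨
    + (p ^ k ℕ.* (p ^ (2 ∸ k) ℕ.* a i)) ≡⟨ cong +_ (sym (ℕP.*-assoc (p ^ k) _ (a i))) ⟩
    + (p ^ k ℕ.* p ^ (2 ∸ k) ℕ.* a i)   ≡⟨ cong (λ c → + (c ℕ.* a i)) (ℕP.^-distribˡ-+-* p k (2 ∸ k)) ⟨
    + (p ^ (k ℕ.+ (2 ∸ k)) ℕ.* a i)     ≡⟨ cong (λ e → + (p ^ e ℕ.* a i)) (ℕP.m+[n∸m]≡n k≤2) ⟩
    + (p ℕ.* (p ℕ.* 1) ℕ.* a i)         ≡⟨ cong (λ c → + (p ℕ.* c ℕ.* a i)) (ℕP.*-identityʳ p) ⟩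
    + (p ℕ.* p ℕ.* a i)                 ≡⟨ ℤP.pos-* (p ℕ.* p) (a i) ⟩
    + (p ℕ.* p) * + a i                 ≡⟨ cong (_* + a i) (ℤP.pos-* p p) ⟩
    + p * + p * + a i                   ∎
    where open ≡-Reasoning

  level-equation : ∀ i (p∤aᵢ : ¬ p ∣ a i) → let j = proj₁ (proj₂ (ndiv-coeff i p∤aᵢ)) in
    + 2 * + p * + r′ i ≡ + (m ∸ 2) * (+ p + + 2 * + j) - (+ (m ∸ 2) - + 2 * + r i)
  level-equation i p∤aᵢ = begin
    + 2 * + p * + r′ i             ≡⟨ cong (_* + r′ i) (ℤP.pos-* 2 p) ⟨
    + (2 ℕ.* p) * + r′ i           ≡⟨ ℤP.pos-* (2 ℕ.* p) (r′ i) ⟨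
    + (2 ℕ.* p ℕ.* r′ i)           ≡⟨ proj₂ (proj₂ (proj₂ (proj₂ (ndiv-coeff i p∤aᵢ)))) ⟩
    + (m ∸ 2) * (+ p + + 2 * + j) - (+ (m ∸ 2) - + (2 ℕ.* r i))
      ≡⟨ cong (λ c → + (m ∸ 2) * (+ p + + 2 * + j) - (+ (m ∸ 2) - c)) (ℤP.pos-* 2 (r i)) ⟩
    + (m ∸ 2) * (+ p + + 2 * + j) - (+ (m ∸ 2) - + 2 * + r i) ∎
    where
    open ≡-Reasoning
    j = proj₁ (proj₂ (ndiv-coeff i p∤aᵢ))

  lift-term : ∀ i y → + a i * P m (r i) (lift i y) ≡ + (p ^ k) * (+ b i * P m (r′ i) y) + + a i * P m (r i) (+ digit i)
  lift-term i y = by-kind (p ℕD.∣? a i)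
    where
    open ≡-Reasoning
    by-kind : (d : Dec (p ∣ a i)) → + a i * P m (r i) (+ digitᵈ i d + y * + scaleᵈ d)
                                     ≡ + (p ^ k) * (+ b i * P m (r′ i) y) + + a i * P m (r i) (+ digitᵈ i d)
    by-kind (yes p∣aᵢ) = begin
      + a i * P m (r i) (+ 0 + y * + 1)                   ≡⟨ cong (λ t → + a i * P m (r i) t) (trans (ℤP.+-identityˡ (y * + 1)) (ℤP.*-identityʳ y)) ⟩
      + a i * P m (r i) y                                 ≡⟨ cong (λ c → + c * P m (r i) y) (proj₁ (div-coeff i p∣aᵢ)) ⟨
      + (p ^ k ℕ.* b i) * P m (r i) y                     ≡⟨ cong (_* P m (r i) y) (ℤP.pos-* (p ^ k) (b i)) ⟩
      + (p ^ k) * + b i * P m (r i) y                     ≡⟨ ℤP.*-assoc (+ (p ^ k)) (+ b i) (P m (r i) y) ⟩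
      + (p ^ k) * (+ b i * P m (r i) y)                   ≡⟨ ℤP.+-identityʳ (+ (p ^ k) * (+ b i * P m (r i) y)) ⟨
      + (p ^ k) * (+ b i * P m (r i) y) + + 0             ≡⟨ cong (λ t → + (p ^ k) * (+ b i * P m (r i) y) + t) a·P0≡0 ⟨
      + (p ^ k) * (+ b i * P m (r i) y) + + a i * P m (r i) (+ 0)
        ≡⟨ cong (λ s → + (p ^ k) * (+ b i * P m s y) + + a i * P m (r i) (+ 0)) (proj₂ (div-coeff i p∣aᵢ)) ⟨
      + (p ^ k) * (+ b i * P m (r′ i) y) + + a i * P m (r i) (+ 0) ∎
      where
      a·P0≡0 : + a i * P m (r i) (+ 0) ≡ + 0
      a·P0≡0 = trans (cong (+ a i *_) (cong₂ _+_ (ℤP.*-zeroʳ (+ (m ∸ 2))) (ℤP.*-zeroʳ (+ r i)))) (ℤP.*-zeroʳ (+ a i))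
    by-kind (no p∤aᵢ) = begin
      + a i * P m (r i) (+ j + y * + p)                         ≡⟨ cong (+ a i *_) (P-λ-substitution m (r i) (r′ i) (+ p) (+ j) y (level-equation i p∤aᵢ)) ⟩
      + a i * (+ p * + p * P m (r′ i) y + P m (r i) (+ j))      ≡⟨ distribute (+ a i) (+ p * + p) (P m (r′ i) y) (P m (r i) (+ j)) ⟩
      + p * + p * + a i * P m (r′ i) y + + a i * P m (r i) (+ j) ≡⟨ cong (λ c → c * P m (r′ i) y + + a i * P m (r i) (+ j)) (pᵏbᵢ≡p²aᵢ i p∤aᵢ) ⟨
      + (p ^ k) * + b i * P m (r′ i) y + + a i * P m (r i) (+ j) ≡⟨ cong (_+ + a i * P m (r i) (+ j)) (ℤP.*-assoc (+ (p ^ k)) (+ b i) (P m (r′ i) y)) ⟩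
      + (p ^ k) * (+ b i * P m (r′ i) y) + + a i * P m (r i) (+ j) ∎
      where
      j = proj₁ (proj₂ (ndiv-coeff i p∤aᵢ))
      distribute : ∀ a q u v → a * (q * u + v) ≡ q * a * u + a * v
      distribute = solve-∀

  C : ℕ
  C = proj₁ (evalΔ-ℕ m n a r digit)

  Δ-lift : ∀ N Y → evalΔ m n a r (λ i → lift i (Y i)) - + (p ^ k ℕ.* N ℕ.+ C) ≡ + (p ^ k) * (evalΔ m n b r′ Y - + N)
  Δ-lift N Y = begin
    evalΔ m n a r (λ i → lift i (Y i)) - + (p ^ k ℕ.* N ℕ.+ C)
      ≡⟨ cong₂ _-_ (sumℤ-cong (λ i → lift-term i (Y i))) (trans (ℤP.pos-+ (p ^ k ℕ.* N) C) (cong (_+ + C) (ℤP.pos-* (p ^ k) N))) ⟩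
    sumℤ (λ i → + (p ^ k) * (+ b i * P m (r′ i) (Y i)) + + a i * P m (r i) (+ digit i)) - (+ (p ^ k) * + N + + C)
      ≡⟨ cong (_- (+ (p ^ k) * + N + + C)) (sumℤ-distrib-+ {n} _ _) ⟩
    sumℤ (λ i → + (p ^ k) * (+ b i * P m (r′ i) (Y i))) + evalΔ m n a r (λ i → + digit i) - (+ (p ^ k) * + N + + C)
      ≡⟨ cong₂ (λ s t → s + t - (+ (p ^ k) * + N + + C)) (*-distribˡ-sumℤ {n} (+ (p ^ k)) _) (sym (proj₂ (evalΔ-ℕ m n a r digit))) ⟨
    + (p ^ k) * evalΔ m n b r′ Y + + C - (+ (p ^ k) * + N + + C)
      ≡⟨ cancel (+ (p ^ k)) (evalΔ m n b r′ Y) (+ N) (+ C) ⟩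
    + (p ^ k) * (evalΔ m n b r′ Y - + N) ∎
    where
    open ≡-Reasoning
    cancel : ∀ q e t c → q * e + c - (q * t + c) ≡ q * (e - t)
    cancel = solve-∀

  locally-lift : ∀ N → LocallyRepresents m n b r′ N → LocallyRepresents m n a r (p ^ k ℕ.* N ℕ.+ C)
  locally-lift N loc q q-prime with loc q q-prime
  ... | Y , ΔY→N = (λ i → affine (+ digit i) (+ scaleᵈ (p ℕD.∣? a i)) (Y i)) , λ e → Product.map₂
    (λ close j K≤j → ℤD.∣⇒∣ᵤ (subst (+ (q ^ e) ∣ℤ_) (sym (Δ-lift N λ i → seq (Y i) j)) (ℤD.∣n⇒∣m*n (+ (p ^ k)) (ℤD.∣ᵤ⇒∣ (close j K≤j)))))
    (ΔY→N e)

  lift-lower : ∀ i x → (¬ p ∣ a i → x % p ≡ digit i) → lift i (+ lowerᵈ (p ℕD.∣? a i) x) ≡ + x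
  lift-lower i x = by-kind (p ℕD.∣? a i)
    where
    open ≡-Reasoning
    by-kind : (d : Dec (p ∣ a i)) → (¬ p ∣ a i → x % p ≡ digitᵈ i d) → + digitᵈ i d + + lowerᵈ d x * + scaleᵈ d ≡ + x
    by-kind (yes _) _ = trans (ℤP.+-identityˡ (+ x * + 1)) (ℤP.*-identityʳ (+ x))
    by-kind (no p∤aᵢ) digit-ok = begin
      + j + + (x / p) * + p     ≡⟨ cong (λ t → + j + t) (ℤP.pos-* (x / p) p) ⟨
      + (j ℕ.+ x / p ℕ.* p)     ≡⟨ cong (λ c → + (c ℕ.+ x / p ℕ.* p)) (digit-ok p∤aᵢ) ⟨
      + (x % p ℕ.+ x / p ℕ.* p) ≡⟨ cong +_ (m≡m%n+[m/n]*n x p) ⟨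
      + x                       ∎
      where
      j = proj₁ (proj₂ (ndiv-coeff i p∤aᵢ))

  unlift : ∀ N (x : Fin n → ℕ) → evalΔ m n a r (λ i → + x i) ≡ + (p ^ k ℕ.* N ℕ.+ C) →
    (∀ i → ¬ p ∣ a i → x i % p ≡ digit i) → Represents m n b r′ N
  unlift N x Δx≡ digits-ok = y , ℤP.i-j≡0⇒i≡j _ _ (ℤP.*-cancelˡ-≡ (+ (p ^ k)) _ _ {{ℕP.m^n≢0 p k}} (begin
    + (p ^ k) * (evalΔ m n b r′ (λ i → + y i) - + N)                  ≡⟨ Δ-lift N (λ i → + y i) ⟨
    evalΔ m n a r (λ i → lift i (+ y i)) - + (p ^ k ℕ.* N ℕ.+ C)     ≡⟨ cong (_- + (p ^ k ℕ.* N ℕ.+ C)) (sumℤ-cong λ i → cong (λ t → + a i * P m (r i) t) (lift-lower i (x i) (digits-ok i))) ⟩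
    evalΔ m n a r (λ i → + x i) - + (p ^ k ℕ.* N ℕ.+ C)              ≡⟨ ℤP.i≡j⇒i-j≡0 Δx≡ ⟩
    + 0                                                              ≡⟨ ℤP.*-zeroʳ (+ (p ^ k)) ⟨
    + (p ^ k) * + 0                                                  ∎))
    where
    open ≡-Reasoning
    y : Fin n → ℕ
    y i = lowerᵈ (p ℕD.∣? a i) (x i)

  1≤k : 1 ℕ.≤ k
  1≤k with k | k-attained
  ... | zero  | inj₁ ()
  ... | zero  | inj₂ (i , p∣aᵢ , p¹∤aᵢ) = contradiction (subst (_∣ a i) (sym (ℕP.*-identityʳ p)) p∣aᵢ) p¹∤aᵢ
  ... | suc _ | _ = ℕ.s≤s ℕ.z≤n

  -- The congruence defining j_i says that j_i is a p-adic critical point of P_m^{(r_i)}.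
  slope-at-digit : ∀ i → ¬ p ∣ a i →
    ∃ λ t → ¬ (+ p ∣ℤ t) × (+ p * (+ 2 * + (m ∸ 2)) ∣ℤ t * slope m (r i) (+ digit i))
  slope-at-digit i p∤aᵢ = by-kind (p ℕD.∣? a i)
    where
    open ≡-Reasoning
    by-kind : (d : Dec (p ∣ a i)) → ∃ λ t → ¬ (+ p ∣ℤ t) × (+ p * (+ 2 * + (m ∸ 2)) ∣ℤ t * slope m (r i) (+ digitᵈ i d))
    by-kind (yes p∣aᵢ) = contradiction p∣aᵢ p∤aᵢ
    by-kind (no p∤aᵢ′) = t , p∤t ∘ ℤD.∣⇒∣ᵤ , divides s (begin
      t * slope m (r i) (+ j)                                   ≡⟨ cong₂ (λ u v → t * (u * + j - (+ (m ∸ 2) - v))) (ℤP.pos-* 2 (m ∸ 2)) (ℤP.pos-* 2 (r i)) ⟨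
      t * (+ (2 ℕ.* (m ∸ 2)) * + j - (+ (m ∸ 2) - + (2 ℕ.* r i))) ≡⟨ congruence ⟩
      + p * + (2 ℕ.* (m ∸ 2)) * s                                ≡⟨ cong (λ u → + p * u * s) (ℤP.pos-* 2 (m ∸ 2)) ⟩
      + p * (+ 2 * + (m ∸ 2)) * s                                ≡⟨ ℤP.*-comm (+ p * (+ 2 * + (m ∸ 2))) s ⟩
      s * (+ p * (+ 2 * + (m ∸ 2)))                              ∎)
      where
      j = proj₁ (proj₂ (ndiv-coeff i p∤aᵢ′))
      critical = proj₁ (proj₂ (proj₂ (proj₂ (ndiv-coeff i p∤aᵢ′))))
      s = proj₁ critical
      t = proj₁ (proj₂ critical)
      p∤t = proj₁ (proj₂ (proj₂ critical))
      congruence = proj₂ (proj₂ (proj₂ critical))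

  regular-if-digits-forced : Regular m n a r →
    (∀ N (x : Fin n → ℕ) → evalΔ m n a r (λ i → + x i) ≡ + (p ^ k ℕ.* N ℕ.+ C) →
      ∀ i → ¬ p ∣ a i → ¬ ¬ (x i % p ≡ digit i)) →
    Regular m n b r′
  regular-if-digits-forced reg forced N loc =
    let x , Δx≡ = reg (p ^ k ℕ.* N ℕ.+ C) (locally-lift N loc)
    in unlift N x Δx≡ λ i p∤aᵢ → decidable-stable (x i % p ℕP.≟ digit i) (forced N x Δx≡ i p∤aᵢ)

  module Deviation (N : ℕ) (x : Fin n → ℕ) (Δx≡ : evalΔ m n a r (λ i → + x i) ≡ + (p ^ k ℕ.* N ℕ.+ C)) where

    J Z : Fin n → ℤ
    J i = + digit i
    Z i = + x i - J i

    double-excess : + 2 * (+ (p ^ k) * + N) ≡ + (m ∸ 2) * Qa a Z Z + derivΔ m a r J Z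
    double-excess = begin
      + 2 * (+ (p ^ k) * + N)                              ≡⟨ cong (+ 2 *_) excess ⟩
      + 2 * (evalΔ m n a r (λ i → J i + + 1 * Z i) - ΔJ)   ≡⟨ distribute (evalΔ m n a r (λ i → J i + + 1 * Z i)) ΔJ ⟩
      + 2 * evalΔ m n a r (λ i → J i + + 1 * Z i) - + 2 * ΔJ ≡⟨ cong (_- + 2 * ΔJ) (double-Δ-line m n a r J Z (+ 1)) ⟩
      + (m ∸ 2) * Qa a Z Z * + 1 * + 1 + derivΔ m a r J Z * + 1 + + 2 * ΔJ - + 2 * ΔJ
        ≡⟨ simplify (+ (m ∸ 2) * Qa a Z Z) (derivΔ m a r J Z) (+ 2 * ΔJ) ⟩
      + (m ∸ 2) * Qa a Z Z + derivΔ m a r J Z              ∎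
      where
      open ≡-Reasoning
      ΔJ = evalΔ m n a r J
      excess : + (p ^ k) * + N ≡ evalΔ m n a r (λ i → J i + + 1 * Z i) - ΔJ
      excess = begin
        + (p ^ k) * + N                         ≡⟨ ℤP.pos-* (p ^ k) N ⟨
        + (p ^ k ℕ.* N)                         ≡⟨ cancel (+ (p ^ k ℕ.* N)) (+ C) ⟨
        + (p ^ k ℕ.* N) + + C - + C             ≡⟨ cong₂ _-_ (trans (sym (ℤP.pos-+ (p ^ k ℕ.* N) C)) (sym Δx≡)) (sym (proj₂ (evalΔ-ℕ m n a r digit))) ⟩
        evalΔ m n a r (λ i → + x i) - ΔJ        ≡⟨ cong (_- ΔJ) (sumℤ-cong λ i → cong (λ t → + a i * P m (r i) t) (recombine (+ x i) (J i))) ⟩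
        evalΔ m n a r (λ i → J i + + 1 * Z i) - ΔJ ∎
        where
        cancel : ∀ u c → u + c - c ≡ u
        cancel = solve-∀
        recombine : ∀ x j → x ≡ j + + 1 * (x - j)
        recombine = solve-∀
      distribute : ∀ e c → + 2 * (e - c) ≡ + 2 * e - + 2 * c
      distribute = solve-∀
      simplify : ∀ q d c → q * + 1 * + 1 + d * + 1 + c - c ≡ q + d
      simplify = solve-∀

    Z-off-digit : ∀ i → ¬ p ∣ a i → x i % p ≢ digit i → ¬ (+ p ∣ℤ Z i)
    Z-off-digit i p∤aᵢ = by-kind (p ℕD.∣? a i)
      where
      by-kind : (d : Dec (p ∣ a i)) → x i % p ≢ digitᵈ i d → ¬ (+ p ∣ℤ + x i - + digitᵈ i d)
      by-kind (yes p∣aᵢ) _ _ = p∤aᵢ p∣aᵢ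
      by-kind (no p∤aᵢ′) x≢j p∣x-j = x≢j (residue-unique (m%n<n (x i) p) j<p
        (subst (+ p ∣ℤ_) (drop-multiple (+ (x i % p)) (+ (x i / p)) (+ p) (+ j))
          (ℤD.∣m∣n⇒∣m-n (subst (λ t → + p ∣ℤ t - + j) x≡ p∣x-j) (divides (+ (x i / p)) refl))))
        where
        j = proj₁ (proj₂ (ndiv-coeff i p∤aᵢ′))
        j<p = proj₁ (proj₂ (proj₂ (ndiv-coeff i p∤aᵢ′)))
        x≡ : + x i ≡ + (x i % p) + + (x i / p) * + p
        x≡ = trans (cong +_ (m≡m%n+[m/n]*n (x i) p)) (trans (ℤP.pos-+ (x i % p) (x i / p ℕ.* p)) (cong (λ t → + (x i % p) + t) (ℤP.pos-* (x i / p) p)))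
        drop-multiple : ∀ ρ q p j → ρ + q * p - j - q * p ≡ ρ - j
        drop-multiple = solve-∀

module OddLambda (m n : ℕ) (a r b r′ : Fin n → ℕ) {p : ℕ} (pr : Prime p) (L : IsLambda m n a r p b r′)
                 (2∤p : ¬ 2 ∣ p) (shifted : ShiftedForm m n a r) where
  open LambdaStep m n a r b r′ pr L

  p∤2 : ¬ (+ p ∣ℤ + 2)
  p∤2 p∣2 with prime⇒irreducible prime[2] (ℤD.∣⇒∣ᵤ p∣2)
  ... | inj₁ refl = ¬prime[1] pr
  ... | inj₂ refl = 2∤p ℕD.∣-refl

  p∣slope : ∀ i → ¬ p ∣ a i → + p ∣ℤ slope m (r i) (+ digit i)
  p∣slope i p∤aᵢ = Sum.[ (λ p∣t → contradiction p∣t p∤t) , id ]′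
    (euclidsLemmaℤ t (slope m (r i) (+ digit i)) pr
      (ℤD.∣-trans (divides (+ 2 * + (m ∸ 2)) (ℤP.*-comm (+ p) (+ 2 * + (m ∸ 2)))) p2D∣tσ))
    where
    t = proj₁ (slope-at-digit i p∤aᵢ)
    p∤t = proj₁ (proj₂ (slope-at-digit i p∤aᵢ))
    p2D∣tσ = proj₂ (proj₂ (slope-at-digit i p∤aᵢ))

  -- p ∣ m - 2 would force p ∣ 2 r_i through the critical-point congruence, against gcd(r_i, m - 2) = 1.
  p∤m-2 : ∀ i → ¬ p ∣ a i → ¬ (+ p ∣ℤ + (m ∸ 2))
  p∤m-2 i p∤aᵢ p∣D = Sum.[ p∤2 , p∤r ]′ (euclidsLemmaℤ (+ 2) (+ r i) pr
    (subst (+ p ∣ℤ_) (solve-for-r (+ (m ∸ 2)) (+ digit i) (+ r i))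
      (ℤD.∣m∣n⇒∣m+n (ℤD.∣m∣n⇒∣m-n (p∣slope i p∤aᵢ) (ℤD.∣n⇒∣m*n (+ 2 * + digit i) p∣D)) p∣D)))
    where
    solve-for-r : ∀ D j r → + 2 * D * j - (D - + 2 * r) - + 2 * j * D + D ≡ + 2 * r
    solve-for-r = solve-∀
    p∤r : ¬ (+ p ∣ℤ + r i)
    p∤r p∣r = ¬prime[1] (subst Prime (proj₂ (proj₂ (proj₂ shifted i)) (ℤD.∣⇒∣ᵤ p∣r , ℤD.∣⇒∣ᵤ p∣D)) pr)

  -- Along the line (J + e_{i₀}) + y Z the quadratic coefficient is divisible by p and the linear one is not.
  universal-if-digit-missed : ∀ N x → (Δx≡ : evalΔ m n a r (λ i → + x i) ≡ + (p ^ k ℕ.* N ℕ.+ C)) →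
    ∀ i₀ → ¬ p ∣ a i₀ → x i₀ % p ≢ digit i₀ → ZpUniversal m n a r p
  universal-if-digit-missed N x Δx≡ i₀ p∤aᵢ₀ off =
    ZpUniversal-from-line m n a r pr p∤2 (λ i → J i + δ i₀ i) Z p∣DQ p∤β
    where
    open Deviation N x Δx≡
    D = + (m ∸ 2)

    p∣deriv : + p ∣ℤ derivΔ m a r J Z
    p∣deriv = sumℤ-∣ _ λ i → ℤD.∣m⇒∣m*n (Z i) (term i (p ℕD.∣? a i))
      where
      term : ∀ i → Dec (p ∣ a i) → + p ∣ℤ + a i * slope m (r i) (J i)
      term i (yes p∣aᵢ) = ℤD.∣m⇒∣m*n {+ p} {+ a i} (slope m (r i) (J i)) (ℤD.∣ᵤ⇒∣ p∣aᵢ)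
      term i (no p∤aᵢ)  = ℤD.∣n⇒∣m*n (+ a i) (p∣slope i p∤aᵢ)

    p∣DQ : + p ∣ℤ D * Qa a Z Z
    p∣DQ = subst (+ p ∣ℤ_) (i≡j+k⇒i-k≡j (D * Qa a Z Z) (derivΔ m a r J Z) double-excess)
      (ℤD.∣m∣n⇒∣m-n (ℤD.∣n⇒∣m*n (+ 2) (ℤD.∣m⇒∣m*n (+ N) p∣pᵏ)) p∣deriv)
      where
      p∣pᵏ : + p ∣ℤ + (p ^ k)
      p∣pᵏ = ℤD.∣ᵤ⇒∣ (subst (_∣ p ^ k) (ℕP.*-identityʳ p) (^-mono-∣ p 1≤k))

    p∤β : ¬ (+ p ∣ℤ derivΔ m a r (λ i → J i + δ i₀ i) Z)
    p∤β p∣β = Sum.[ Sum.[ p∤2 , p∤m-2 i₀ p∤aᵢ₀ ]′ ∘ euclidsLemmaℤ (+ 2) D pr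
                  , Sum.[ p∤aᵢ₀ ∘ ℤD.∣⇒∣ᵤ , Z-off-digit i₀ p∤aᵢ₀ off ]′ ∘ euclidsLemmaℤ (+ a i₀) (Z i₀) pr ]′
      (euclidsLemmaℤ (+ 2 * D) (+ a i₀ * Z i₀) pr
        (ℤD.∣m+n∣m⇒∣n (subst (+ p ∣ℤ_) (derivΔ-shift m a r J Z i₀) p∣β) p∣deriv))

module TwoAdicLambda (m n : ℕ) (a r b r′ : Fin n → ℕ) (L : IsLambda m n a r 2 b r′)
                     (4∣m : 4 ∣ m) (shifted : ShiftedForm m n a r) where
  open LambdaStep m n a r b r′ prime[2] L

  o : ℤ
  o = + (2 ℕ.* proj₁ (m-2≡2*odd 4∣m (proj₁ shifted)) ℕ.+ 1)

  D≡2o : + (m ∸ 2) ≡ + 2 * o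
  D≡2o = trans (cong +_ (proj₂ (m-2≡2*odd 4∣m (proj₁ shifted)))) (ℤP.pos-* 2 (2 ℕ.* proj₁ (m-2≡2*odd 4∣m (proj₁ shifted)) ℕ.+ 1))

  o-odd : ¬ (+ 2 ∣ℤ o)
  o-odd 2∣o with ℕD.∣1⇒≡1 (ℕD.∣m+n∣m⇒∣n (ℤD.∣⇒∣ᵤ 2∣o) (ℕD.m∣m*n (proj₁ (m-2≡2*odd 4∣m (proj₁ shifted)))))
  ... | ()

  2∣slope : ∀ r w → + 2 ∣ℤ slope m r w
  2∣slope r w = divides (+ 2 * o * w - o + + r) (begin
    + 2 * + (m ∸ 2) * w - (+ (m ∸ 2) - + 2 * + r) ≡⟨ cong (λ D → + 2 * D * w - (D - + 2 * + r)) D≡2o ⟩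
    + 2 * (+ 2 * o) * w - (+ 2 * o - + 2 * + r)   ≡⟨ halve o w (+ r) ⟩
    (+ 2 * o * w - o + + r) * + 2                 ∎)
    where
    open ≡-Reasoning
    halve : ∀ o w r → + 2 * (+ 2 * o) * w - (+ 2 * o - + 2 * r) ≡ (+ 2 * o * w - o + r) * + 2
    halve = solve-∀

  8∣slope : ∀ i → ¬ 2 ∣ a i → + 8 ∣ℤ slope m (r i) (+ digit i)
  8∣slope i 2∤aᵢ = prime^e-cancelˡℤ 3 t prime[2] 2∤t (ℤD.∣-trans 8∣4D 4D∣tσ)
    where
    t = proj₁ (slope-at-digit i 2∤aᵢ)
    2∤t = proj₁ (proj₂ (slope-at-digit i 2∤aᵢ))
    4D∣tσ = proj₂ (proj₂ (slope-at-digit i 2∤aᵢ))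
    8∣4D : + 8 ∣ℤ + 2 * (+ 2 * + (m ∸ 2))
    8∣4D = divides o (trans (cong (λ D → + 2 * (+ 2 * D)) D≡2o) (regroup o))
      where
      regroup : ∀ o → + 2 * (+ 2 * (+ 2 * o)) ≡ o * + 8
      regroup = solve-∀

  k≡1⊎k≡2 : k ≡ 1 ⊎ k ≡ 2
  k≡1⊎k≡2 with k | 1≤k | k≤2
  ... | 1 | _ | _ = inj₁ refl
  ... | 2 | _ | _ = inj₂ refl
  ... | suc (suc (suc _)) | _ | ℕ.s≤s (ℕ.s≤s ())

  ⟨1,3⟩-if-digit-missed : ∀ N x → (Δx≡ : evalΔ m n a r (λ i → + x i) ≡ + (2 ^ k ℕ.* N ℕ.+ C)) →
    ∀ i₀ → ¬ 2 ∣ a i₀ → x i₀ % 2 ≢ digit i₀ → Represents⟨1,3⟩ n a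
  ⟨1,3⟩-if-digit-missed N x Δx≡ i₀ 2∤aᵢ₀ off = by-cases (+ 4 ℤD.∣? Qa a Z Z)
    where
    open Deviation N x Δx≡
    open CoordinateSplit a Z i₀ 2∤aᵢ₀ (Z-off-digit i₀ 2∤aᵢ₀ off)

    2ᵏ⁺¹∣deriv : + (2 ^ suc k) ∣ℤ derivΔ m a r J Z
    2ᵏ⁺¹∣deriv = sumℤ-∣ _ λ i → ℤD.∣m⇒∣m*n (Z i) (term i (2 ℕD.∣? a i))
      where
      term : ∀ i → Dec (2 ∣ a i) → + (2 ^ suc k) ∣ℤ + a i * slope m (r i) (J i)
      term i (yes 2∣aᵢ) = subst (_∣ℤ + a i * slope m (r i) (J i)) (trans (sym (ℤP.pos-* (2 ^ k) 2)) (cong +_ (ℕP.*-comm (2 ^ k) 2)))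
        (*-pres-∣ℤ (ℤD.∣ᵤ⇒∣ {+ (2 ^ k)} {+ a i} (k-lower i 2∣aᵢ)) (2∣slope (r i) (J i)))
      term i (no 2∤aᵢ)  = ℤD.∣n⇒∣m*n (+ a i) (ℤD.∣-trans (ℤD.∣ᵤ⇒∣ (^-mono-∣ 2 (ℕ.s≤s k≤2))) (8∣slope i 2∤aᵢ))

    2ᵏ∣Q : + (2 ^ k) ∣ℤ Qa a Z Z
    2ᵏ∣Q = prime^e-cancelˡℤ k o prime[2] o-odd (ℤD.*-cancelˡ-∣ (+ 2) (subst₂ _∣ℤ_ (ℤP.pos-* 2 (2 ^ k)) 2[oQ]≡ 2ᵏ⁺¹∣DQ))
      where
      2ᵏ⁺¹∣DQ : + (2 ^ suc k) ∣ℤ + (m ∸ 2) * Qa a Z Z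
      2ᵏ⁺¹∣DQ = subst (+ (2 ^ suc k) ∣ℤ_) (i≡j+k⇒i-k≡j (+ (m ∸ 2) * Qa a Z Z) (derivΔ m a r J Z) double-excess)
        (ℤD.∣m∣n⇒∣m-n (divides (+ N) (trans (regroup (+ (2 ^ k)) (+ N)) (cong (+ N *_) (sym (ℤP.pos-* 2 (2 ^ k)))))) 2ᵏ⁺¹∣deriv)
        where
        regroup : ∀ q N → + 2 * (q * N) ≡ N * (+ 2 * q)
        regroup = solve-∀
      2[oQ]≡ : + (m ∸ 2) * Qa a Z Z ≡ + 2 * (o * Qa a Z Z)
      2[oQ]≡ = trans (cong (_* Qa a Z Z) D≡2o) (ℤP.*-assoc (+ 2) o (Qa a Z Z))

    by-cases : Dec (+ 4 ∣ℤ Qa a Z Z) → Represents⟨1,3⟩ n a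
    by-cases (yes 4∣Q) = ⟨1,3⟩-if-4∣Q 4∣Q
    by-cases (no 4∤Q) = Sum.[ k≡1-case , (λ k≡2 → contradiction (subst (λ e → + (2 ^ e) ∣ℤ Qa a Z Z) k≡2 2ᵏ∣Q) 4∤Q) ]′ k≡1⊎k≡2
      where
      k≡1-case : k ≡ 1 → Represents⟨1,3⟩ n a
      k≡1-case k≡1 = Sum.[ (λ k≡2 → contradiction (trans (sym k≡1) k≡2) λ ()) , attained ]′ k-attained
        where
        attained : ∃ (λ d → 2 ∣ a d × ¬ (2 ^ suc k ∣ a d)) → Represents⟨1,3⟩ n a
        attained (d , 2∣a_d , 2ᵏ⁺¹∤a_d) = ⟨1,3⟩-if-2∥Q (subst (λ e → + (2 ^ e) ∣ℤ Qa a Z Z) k≡1 2ᵏ∣Q) 4∤Q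
                                             d 2∣a_d (subst (λ e → ¬ 2 ^ suc e ∣ a d) k≡1 2ᵏ⁺¹∤a_d)

lemma4p1 : (m n : ℕ) (a r : Fin n → ℕ) →
    ShiftedForm m n a r → Primitive n a → Regular m n a r →
    ((p : ℕ) → Prime p → ¬ (2 ∣ p) → ¬ ZpUniversal m n a r p →
      (b r' : Fin n → ℕ) → IsLambda m n a r p b r' → Regular m n b r')
    ×
    (4 ∣ m →
      ((u u' : ℤp 2) → CongZp u (+ 1) 2 → CongZp u' (+ 3) 2 → ¬ RepresentsBinary2 n a u u') →
      (b r' : Fin n → ℕ) → IsLambda m n a r 2 b r' → Regular m n b r')
lemma4p1 m n a r shifted _ regular = odd-prime , prime-two
  where
  odd-prime : (p : ℕ) → Prime p → ¬ (2 ∣ p) → ¬ ZpUniversal m n a r p →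
    (b r′ : Fin n → ℕ) → IsLambda m n a r p b r′ → Regular m n b r′
  odd-prime p pr 2∤p not-universal b r′ L = regular-if-digits-forced regular
    λ N x Δx≡ i p∤aᵢ off → not-universal (universal-if-digit-missed N x Δx≡ i p∤aᵢ off)
    where
    open LambdaStep m n a r b r′ pr L
    open OddLambda m n a r b r′ pr L 2∤p shifted

  prime-two : 4 ∣ m →
    ((u u′ : ℤp 2) → CongZp u (+ 1) 2 → CongZp u′ (+ 3) 2 → ¬ RepresentsBinary2 n a u u′) →
    (b r′ : Fin n → ℕ) → IsLambda m n a r 2 b r′ → Regular m n b r′
  prime-two 4∣m no-⟨1,3⟩ b r′ L = regular-if-digits-forced regular
    λ N x Δx≡ i 2∤aᵢ off → let (u , u′ , u≡1 , u′≡3 , represents) = ⟨1,3⟩-if-digit-missed N x Δx≡ i 2∤aᵢ off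
                           in no-⟨1,3⟩ u u′ u≡1 u′≡3 represents
    where
    open LambdaStep m n a r b r′ prime[2] L
    open TwoAdicLambda m n a r b r′ L 4∣m shifted
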